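{- Let $G$ be an MO-graph with chain-vertices, and let $G'$ be the MO-graph with chain-vertices obtained from $G$ by consistently substituting a chain-vertex by a chain of dipoles. Then $G$ and $G'$ have the same degree.
   Context: An MO-graph is a 4-regular map whose edges are oriented so that at each vertex the two outgoing half-edges are opposite and the two incoming ones are opposite. Each edge carries three strands (left, straight, right); the left and right faces are the faces of the map (edges directed counterclockwise, resp. clockwise, around them), and straight faces are closed walks leaving each vertex through the half-edge opposite to the arriving one. A dipole is a face of length 2 incident to two distinct standard vertices (and not passing through the root-vertex if the graph is rooted, i.e. has a fake degree-2 vertex inserted on a marked edge); its type is L, R or S according to the kind of face. At each of its two vertices a dipole has two exterior half-edges, forming a side. A chain of dipoles is a sequence $d_1,\dots,d_p$, $p\ge2$, of dipoles with, for each $i<p$, two edges joining the two half-edges of a side of $d_i$ to the two half-edges of a side of $d_{i+1}$; it is unbroken if all dipoles have the same type, broken otherwise. An MO-graph with chain-vertices is an oriented 4-regular map having standard vertices (obeying the MO rule) and chain-vertices labelled in $\{L,R,S_e,S_o,B\}$, each having two sides of two half-edges, with orientations as in a chain of its type. Type L (resp. R) stands for an unbroken chain of L-dipoles (resp. R-dipoles), $S_e$ (resp. $S_o$) for an unbroken chain of an even (resp. odd) number of S-dipoles, B for a broken chain. Strands are routed through a chain-vertex as through a chain of its type: at a B chain-vertex every strand returns to its side, the strand-ends of the two half-edges of a side being connected as if these two half-edges were merged into one edge; at an unbroken chain-vertex exactly two strands (the crossing strands) go from one side to the other and all others return to their side. Faces are closed walks of strands. The degree $\delta$ is defined by $2\delta=6c+3V-2F+4U+6B$,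 where $c,V,F,U,B$ are the numbers of connected components, standard vertices, faces, unbroken chain-vertices and broken chain-vertices. Consistently substituting a chain-vertex means replacing it by a chain of at least two dipoles of the corresponding kind, whose two outer sides are attached to the two sides of the chain-vertex. -}

module Defs where

open import Data.Nat using (ℕ; zero; suc; _+_; _*_)
open import Data.Nat.Divisibility using (_∣_)
open import Data.Integer using (ℤ; +_; _-_)
open import Data.Bool using (Bool; true; false; not; T)
open import Data.Bool.Properties using (T-irrelevant)
open import Data.Fin using (Fin; zero; suc; toℕ; lower₁; inject₁)
open import Data.Fin.Properties using () renaming (_≟_ to _≟F_)
open import Data.Product using (Σ; _×_; _,_; proj₁; proj₂)
open import Data.Product.Properties using () renaming (≡-dec to Σ-≡-dec)
open import Data.Sum using (_⊎_; inj₁; inj₂)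
open import Data.Sum.Properties using () renaming (≡-dec to ⊎-≡-dec)
open import Data.Vec using (Vec; lookup)
open import Data.Vec.Relation.Unary.All using (All)
open import Data.Empty using (⊥)
open import Relation.Nullary using (¬_; yes; no)
open import Relation.Nullary.Decidable using (False; fromWitnessFalse)
open import Relation.Binary.Definitions using (DecidableEquality)
open import Relation.Binary.PropositionalEquality using (_≡_; _≢_; refl)
open import Relation.Binary.Construct.Closure.Equivalence using (EqClosure)
open import Function.Bundles using (_↔_)

-- strand types (left, straight, right); also used as dipole types
data Ty : Set where
  L S R : Ty

data Kind : Set where
  std chL chR chSe chSo chB : Kind

pattern s0 = zero
pattern s1 = suc zero
pattern s2 = suc (suc zero)
pattern s3 = suc (suc (suc zero))

-- cyclic operations on the 4 slots of a vertex (slots in counterclockwise order)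
next4 : Fin 4 → Fin 4
next4 s0 = s1
next4 s1 = s2
next4 s2 = s3
next4 s3 = s0

prev4 : Fin 4 → Fin 4
prev4 s0 = s3
prev4 s1 = s0
prev4 s2 = s1
prev4 s3 = s2

opp4 : Fin 4 → Fin 4
opp4 s0 = s2
opp4 s1 = s3
opp4 s2 = s0
opp4 s3 = s1

-- Chain-vertex convention: slots 0,1 form one side, slots 2,3 the other;
-- in each side the first slot is the outgoing half-edge, the second the
-- incoming one (orientation as in a chain of dipoles).

-- strand returns to its side (the two half-edges of a side merged into one edge)
sideRet : Fin 4 → Fin 4
sideRet s0 = s1
sideRet s1 = s0
sideRet s2 = s3
sideRet s3 = s2

-- crossing strand going from an outgoing to an incoming half-edge (and back)
crossIO : Fin 4 → Fin 4
crossIO s0 = s3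
crossIO s1 = s2
crossIO s2 = s1
crossIO s3 = s0

-- strand routing at a vertex: given the kind of the vertex, whether the
-- half-edge at slot i is outgoing, the slot i and the strand type, return the
-- slot of the half-edge where this strand continues (strand types are kept).
routeStd : Bool → Fin 4 → Ty → Fin 4
routeStd false i L = prev4 i   -- incoming half-edge: left strand turns to the cw neighbour
routeStd false i R = next4 i
routeStd false i S = opp4 i
routeStd true  i L = next4 i   -- outgoing half-edge
routeStd true  i R = prev4 i
routeStd true  i S = opp4 i

route : Kind → Bool → Fin 4 → Ty → Fin 4
route std  b i t = routeStd b i t
route chL  _ i L = crossIO i
route chL  _ i S = sideRet i
route chL  _ i R = sideRet i
route chR  _ i L = sideRet i
route chR  _ i S = sideRet i
route chR  _ i R = crossIO i
route chSe _ i L = sideRet i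
route chSe _ i S = crossIO i
route chSe _ i R = sideRet i
route chSo _ i L = sideRet i
route chSo _ i S = opp4 i
route chSo _ i R = sideRet i
route chB  _ i _ = sideRet i

-- MO-graphs with chain-vertices (combinatorial maps: each vertex has four
-- half-edges, slots 0..3 in counterclockwise order; α pairs half-edges into edges;
-- out h = true iff the half-edge h is outgoing)

record MOGraph : Set₁ where
  field
    Vtx   : Set
    _≟V_  : DecidableEquality Vtx
    kind  : Vtx → Kind
    α     : Vtx × Fin 4 → Vtx × Fin 4
    out   : Vtx × Fin 4 → Bool

FiniteGraph : MOGraph → Set
FiniteGraph G = Σ ℕ λ n → MOGraph.Vtx G ↔ Fin n

LocalOK : Kind → (Fin 4 → Bool) → Set
LocalOK std  o = (o s0 ≡ o s2) × (o s1 ≡ o s3) × (o s1 ≡ not (o s0))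
LocalOK chL  o = (o s0 ≡ true) × (o s1 ≡ false) × (o s2 ≡ true) × (o s3 ≡ false)
LocalOK chR  o = (o s0 ≡ true) × (o s1 ≡ false) × (o s2 ≡ true) × (o s3 ≡ false)
LocalOK chSe o = (o s0 ≡ true) × (o s1 ≡ false) × (o s2 ≡ true) × (o s3 ≡ false)
LocalOK chSo o = (o s0 ≡ true) × (o s1 ≡ false) × (o s2 ≡ true) × (o s3 ≡ false)
LocalOK chB  o = (o s0 ≡ true) × (o s1 ≡ false) × (o s2 ≡ true) × (o s3 ≡ false)

record WellFormed (G : MOGraph) : Set where
  open MOGraph G
  field
    α-invol  : ∀ h → α (α h) ≡ h
    α-free   : ∀ h → α h ≢ h
    α-orient : ∀ h → out (α h) ≡ not (out h)
    local    : ∀ x → LocalOK (kind x) (λ i → out (x , i))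

NumClasses : {A : Set} → (A → A → Set) → ℕ → Set
NumClasses {A} Rel k =
  Σ (A → Fin k) λ f →
    (∀ c → Σ A λ x → f x ≡ c) ×
    (∀ x y → (f x ≡ f y → EqClosure Rel x y) × (EqClosure Rel x y → f x ≡ f y))

NumSat : {A : Set} → (A → Bool) → ℕ → Set
NumSat {A} p k = Fin k ↔ Σ A (λ x → T (p x))

isStd : Kind → Bool
isStd std = true
isStd _   = false

isUnbroken : Kind → Bool
isUnbroken chL  = true
isUnbroken chR  = true
isUnbroken chSe = true
isUnbroken chSo = true
isUnbroken _    = false

isBroken : Kind → Bool
isBroken chB = true
isBroken _   = false

module _ (G : MOGraph) where
  open MOGraph G

  Adjacent : Vtx → Vtx → Set
  Adjacent x y = Σ (Fin 4) λ i → Σ (Fin 4) λ j → α (x , i) ≡ (y , j)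

  -- strand-ends: a half-edge together with one of its three strands
  StrandEnd : Set
  StrandEnd = (Vtx × Fin 4) × Ty

  StrandStep : StrandEnd → StrandEnd → Set
  StrandStep ((x , i) , t) e =
    (e ≡ (α (x , i) , t)) ⊎
    (e ≡ ((x , route (kind x) (out (x , i)) i t) , t))

  HasTwiceDegree : ℤ → Set
  HasTwiceDegree d =
    Σ ℕ λ c → Σ ℕ λ nV → Σ ℕ λ nF → Σ ℕ λ nU → Σ ℕ λ nB →
      NumClasses Adjacent c ×
      NumSat (λ x → isStd (kind x)) nV ×
      NumClasses StrandStep nF ×
      NumSat (λ x → isUnbroken (kind x)) nU ×
      NumSat (λ x → isBroken (kind x)) nB ×
      (d ≡ (+ (6 * c + 3 * nV + 4 * nU + 6 * nB)) - (+ (2 * nF)))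

Broken : {m : ℕ} → Vec Ty m → Set
Broken {m} ts = Σ (Fin m) λ i → Σ (Fin m) λ j → lookup ts i ≢ lookup ts j

ChainFits : {m : ℕ} → Kind → Vec Ty m → Set
ChainFits std  ts = ⊥
ChainFits chL  ts = All (_≡ L) ts
ChainFits chR  ts = All (_≡ R) ts
ChainFits {m} chSe ts = All (_≡ S) ts × (2 ∣ m)
ChainFits {m} chSo ts = All (_≡ S) ts × ¬ (2 ∣ m)
ChainFits chB  ts = Broken ts

-- role of the half-edge at slot k of the vertex s (0 = u, 1 = w) of a dipole
-- of a given type: either joined inside the dipole to (vertex, slot), or an
-- exterior half-edge in a side (0 or 1) at a position (0 = outgoing, 1 = incoming).
-- All dipole vertices have outgoing half-edges at slots 0 and 2.
data Role : Set where
  inner : Fin 2 → Fin 4 → Role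
  ext   : Fin 2 → Fin 2 → Role

pattern vu = zero
pattern vw = suc zero
pattern p0 = zero
pattern p1 = suc zero

-- L-dipole: u0 → w1, w0 → u1 (left face of length 2);
--   side 0 = (u2 out, w3 in), side 1 = (w2 out, u3 in)
-- R-dipole: u0 → w1, w2 → u3 (right face of length 2);
--   side 0 = (w0 out, u1 in), side 1 = (u2 out, w3 in)
-- S-dipole: u0 → w1, u2 → w3 (straight face of length 2);
--   side 0 = (w0 out, u1 in), side 1 = (w2 out, u3 in)
role : Ty → Fin 2 → Fin 4 → Role
role L vu s0 = inner vw s1
role L vu s1 = inner vw s0
role L vu s2 = ext p0 p0
role L vu s3 = ext p1 p1
role L vw s0 = inner vu s1
role L vw s1 = inner vu s0
role L vw s2 = ext p1 p0
role L vw s3 = ext p0 p1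
role R vu s0 = inner vw s1
role R vu s1 = ext p0 p1
role R vu s2 = ext p1 p0
role R vu s3 = inner vw s2
role R vw s0 = ext p0 p0
role R vw s1 = inner vu s0
role R vw s2 = inner vu s3
role R vw s3 = ext p1 p1
role S vu s0 = inner vw s1
role S vu s1 = ext p0 p1
role S vu s2 = inner vw s3
role S vu s3 = ext p1 p1
role S vw s0 = ext p0 p0
role S vw s1 = inner vu s0
role S vw s2 = ext p1 p0
role S vw s3 = inner vu s2

extH : Ty → Fin 2 → Fin 2 → Fin 2 × Fin 4
extH L p0 p0 = vu , s2
extH L p0 p1 = vw , s3
extH L p1 p0 = vw , s2
extH L p1 p1 = vu , s3
extH R p0 p0 = vw , s0
extH R p0 p1 = vu , s1
extH R p1 p0 = vu , s2
extH R p1 p1 = vw , s3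
extH S p0 p0 = vw , s0
extH S p0 p1 = vu , s1
extH S p1 p0 = vw , s2
extH S p1 p1 = vu , s3

flip2 : Fin 2 → Fin 2
flip2 p0 = p1
flip2 p1 = p0

evenSlot : Fin 4 → Bool
evenSlot s0 = true
evenSlot s1 = false
evenSlot s2 = true
evenSlot s3 = false

chainSlot : Fin 2 → Fin 2 → Fin 4
chainSlot p0 p0 = s0
chainSlot p0 p1 = s1
chainSlot p1 p0 = s2
chainSlot p1 p1 = s3

-- Substitution of the chain-vertex v by the chain of dipoles d_0 … d_{q+1}
-- of types ts: side 1 of d_i is joined to side 0 of d_{i+1} (outgoing to
-- incoming), side 0 of d_0 replaces side 0 (slots 0,1) of v, side 1 of the
-- last dipole replaces side 1 (slots 2,3) of v.

module Substitution (G : MOGraph) (v : MOGraph.Vtx G) {q : ℕ}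
                    (ts : Vec Ty (suc (suc q))) where
  open MOGraph G

  Old : Set
  Old = Σ Vtx λ x → False (x ≟V v)

  Dip : Set
  Dip = Fin (suc (suc q)) × Fin 2

  Vtx' : Set
  Vtx' = Old ⊎ Dip

  _≟'_ : DecidableEquality Vtx'
  _≟'_ = ⊎-≡-dec (Σ-≡-dec _≟V_ (λ a b → yes (T-irrelevant a b)))
                 (Σ-≡-dec _≟F_ _≟F_)

  lastD : Fin (suc (suc q))
  lastD = Data.Fin.fromℕ (suc q)

  dipHE : Fin (suc (suc q)) → Fin 2 → Fin 2 → Vtx' × Fin 4
  dipHE i sd ps = inj₂ (i , proj₁ (extH (lookup ts i) sd ps)) ,
                  proj₂ (extH (lookup ts i) sd ps)

  attach : Fin 4 → Vtx' × Fin 4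
  attach s0 = dipHE zero p0 p0
  attach s1 = dipHE zero p0 p1
  attach s2 = dipHE lastD p1 p0
  attach s3 = dipHE lastD p1 p1

  -- a half-edge of G (the partner of some half-edge) seen in G'
  resolve : Vtx × Fin 4 → Vtx' × Fin 4
  resolve (y , j) with y ≟V v
  ... | yes _ = attach j
  ... | no ¬p = inj₁ (y , fromWitnessFalse ¬p) , j

  sidePartner : Fin (suc (suc q)) → Fin 2 → Fin 2 → Vtx' × Fin 4
  sidePartner zero    p0 ps = resolve (α (v , chainSlot p0 ps))
  sidePartner (suc j) p0 ps = dipHE (inject₁ j) p1 (flip2 ps)
  sidePartner i       p1 ps with suc q Data.Nat.≟ toℕ i
  ... | yes _ = resolve (α (v , chainSlot p1 ps))
  ... | no ne = dipHE (suc (lower₁ i ne)) p0 (flip2 ps)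

  roleHE : Fin (suc (suc q)) → Role → Vtx' × Fin 4
  roleHE i (inner s' k') = inj₂ (i , s') , k'
  roleHE i (ext sd ps)   = sidePartner i sd ps

  α' : Vtx' × Fin 4 → Vtx' × Fin 4
  α' (inj₁ (x , _) , k)   = resolve (α (x , k))
  α' (inj₂ (i , s) , k)   = roleHE i (role (lookup ts i) s k)

  kind' : Vtx' → Kind
  kind' (inj₁ (x , _)) = kind x
  kind' (inj₂ _)       = std

  out' : Vtx' × Fin 4 → Bool
  out' (inj₁ (x , _) , k) = out (x , k)
  out' (inj₂ _ , k)       = evenSlot k

  result : MOGraph
  result = record
    { Vtx  = Vtx'
    ; _≟V_ = _≟'_
    ; kind = kind'
    ; α    = α'
    ; out  = out'
    }

substitute : (G : MOGraph) → MOGraph.Vtx G → {q : ℕ} →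
             Vec Ty (suc (suc q)) → MOGraph
substitute G v ts = Substitution.result G v ts

module Submission where

-- Up to isomorphism, substituting the chain d₁ … d_p for a chain-vertex v is a
-- sequence of local replacements: v becomes the dipole d₁ followed by a
-- chain-vertex standing for d₂ … d_p, and finally a chain-vertex standing for
-- two dipoles becomes these two dipoles.  Replacing a vertex by a connected
-- gadget whose strands join its ports exactly as v routed them keeps the
-- components, keeps the faces through v, and adds the K faces closed up inside
-- the gadget.  For each of the finitely many gadgets these facts are checked by
-- evaluation, together with the balance 3ΔV + 4ΔU + 6ΔB = 2K, so that
-- 2δ = 6c + 3V − 2F + 4U + 6B does not change.

open import Defs
open import Data.Bool using (Bool; true; false; T; not; if_then_else_; _∧_; _∨_)
open import Data.Bool.Properties using (T-irrelevant; T-∧)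
open import Data.Empty using (⊥-elim)
open import Data.Fin using (Fin; zero; suc; toℕ; splitAt; join; _↑ˡ_; _↑ʳ_; punchIn; punchOut)
open import Data.Fin.Properties
  using (+↔⊎; all?; any?; splitAt-join; join-splitAt; lower₁-irrelevant;
         punchOut-injective; punchOut-cong; punchInᵢ≢i; punchOut-punchIn)
  renaming (_≟_ to _≟F_)
open import Data.Integer using (ℤ; +_; _-_; _⊖_)
open import Data.Integer.Properties using ([+m]-[+n]≡m⊖n; +-cancelˡ-⊖)
open import Data.List
  using (List; []; _∷_; length; allFin; filterᵇ; findIndexᵇ; cartesianProduct; foldr)
import Data.List as List
open import Data.Maybe using (Maybe; just; maybe′)
import Data.Nat as ℕ
open import Data.Nat using (ℕ; zero; suc; _+_; _*_; _<ᵇ_; _≡ᵇ_)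
open import Data.Nat.Divisibility
  using (_∣_; _∣0; ∣-refl; ∣1⇒≡1; ∣m∣n⇒∣m+n; ∣m+n∣m⇒∣n)
open import Data.Nat.Properties
  using (suc-injective; ≡ᵇ⇒≡; +-identityʳ; +-suc; +-assoc; +-comm; +-cancelʳ-≡; *-distribˡ-+)
open import Data.Nat.Tactic.RingSolver using (solve-∀)
open import Data.Product using (Σ; ∃; _×_; _,_; proj₁; proj₂; map₁; uncurry)
open import Data.Product.Properties using (Σ-≡,≡→≡) renaming (≡-dec to Σ-≡-dec)
open import Data.Sum using (_⊎_; inj₁; inj₂)
import Data.Sum as Sum
open import Data.Sum.Function.Propositional using (_⊎-↔_)
open import Data.Sum.Properties using (inj₁-injective) renaming (≡-dec to ⊎-≡-dec)
open import Data.Sum.Relation.Binary.Pointwise as Pointwise using (Pointwise; ⊎-isEquivalence)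
open import Data.Unit using (tt)
open import Data.Vec using (Vec; []; _∷_; head; lookup)
open import Data.Vec.Relation.Unary.All using (All; []; _∷_)
open import Data.Vec.Relation.Unary.All.Properties using (lookup⁺)
open import Function using (_∘_; id)
open import Function.Bundles using (_↔_; Inverse; Equivalence; mk↔ₛ′)
open import Function.Properties.Inverse using (↔-trans; ↔-sym; ↔-refl)
open import Level using (0ℓ)
open import Relation.Binary.Core using (Rel)
open import Relation.Binary.Construct.Closure.Equivalence as EqClosure using (EqClosure)
open import Relation.Binary.Construct.Closure.ReflexiveTransitive using (ε; _◅◅_)
open import Relation.Binary.Construct.Never using (Never)
open import Relation.Binary.Definitions using (DecidableEquality)
open import Relation.Binary.PropositionalEquality
  using (_≡_; _≢_; refl; sym; trans; cong; cong₂; subst; module ≡-Reasoning)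
import Relation.Binary.PropositionalEquality.Properties as ≡
open import Relation.Nullary using (¬_; Dec; yes; no)
open import Relation.Nullary.Decidable
  using (⌊_⌋; T?; toWitness; False; fromWitnessFalse; toWitnessFalse)

private
  variable
    A B I : Set
    _∼_ : Rel A 0ℓ
    _≈_ : Rel B 0ℓ
    k m : ℕ

≡⇒EqClosure : {x y : A} → x ≡ y → EqClosure _∼_ x y
≡⇒EqClosure refl = ε

EqClosure-respects : (f : A → B) → (∀ {x y} → x ∼ y → f x ≡ f y) →
  ∀ {x y} → EqClosure _∼_ x y → f x ≡ f y
EqClosure-respects f = EqClosure.gfold ≡.isEquivalence f

-- Counting equivalence classes

record ClassEquivalence (_∼_ : Rel A 0ℓ) (_≈_ : Rel B 0ℓ) : Set where
  field
    to        : A → B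
    from      : B → A
    to-cong   : ∀ {x y} → x ∼ y → EqClosure _≈_ (to x) (to y)
    from-cong : ∀ {x y} → x ≈ y → EqClosure _∼_ (from x) (from y)
    from∘to   : ∀ x → EqClosure _∼_ (from (to x)) x
    to∘from   : ∀ y → EqClosure _≈_ (to (from y)) y

  to-cong⋆ : ∀ {x y} → EqClosure _∼_ x y → EqClosure _≈_ (to x) (to y)
  to-cong⋆ = EqClosure.gfold (EqClosure.isEquivalence _≈_) to to-cong

  from-cong⋆ : ∀ {x y} → EqClosure _≈_ x y → EqClosure _∼_ (from x) (from y)
  from-cong⋆ = EqClosure.gfold (EqClosure.isEquivalence _∼_) from from-cong

ClassEquivalence-sym : ClassEquivalence _∼_ _≈_ → ClassEquivalence _≈_ _∼_
ClassEquivalence-sym E = record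
  { to = from ; from = to ; to-cong = from-cong ; from-cong = to-cong
  ; from∘to = to∘from ; to∘from = from∘to }
  where open ClassEquivalence E

numClasses-transport : ClassEquivalence _∼_ _≈_ → NumClasses _∼_ k → NumClasses _≈_ k
numClasses-transport {_∼_ = _∼_} {_≈_ = _≈_} E (h , onto , classes) =
  h ∘ from , onto′ , λ x y → cls⇒ x y , cls⇐ x y
  where
  open ClassEquivalence E
  onto′ : ∀ c → ∃ λ y → h (from y) ≡ c
  onto′ c = let x , hx≡c = onto c in
    to x , trans (proj₂ (classes _ _) (from∘to x)) hx≡c
  cls⇒ : ∀ x y → h (from x) ≡ h (from y) → EqClosure _≈_ x y
  cls⇒ x y eq = EqClosure.symmetric _≈_ (to∘from x)
    ◅◅ to-cong⋆ (proj₁ (classes _ _) eq) ◅◅ to∘from y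
  cls⇐ : ∀ x y → EqClosure _≈_ x y → h (from x) ≡ h (from y)
  cls⇐ x y x∼y = proj₂ (classes _ _) (from-cong⋆ x∼y)

data WithIsolated (_∼_ : Rel A 0ℓ) (I : Set) : Rel (A ⊎ I) 0ℓ where
  lift : ∀ {x y} → x ∼ y → WithIsolated _∼_ I (inj₁ x) (inj₁ y)

withIsolated-classes : ∀ {x y} → EqClosure (WithIsolated _∼_ I) x y →
  Pointwise (EqClosure _∼_) _≡_ x y
withIsolated-classes {_∼_ = _∼_} = EqClosure.fold
  (⊎-isEquivalence (EqClosure.isEquivalence _∼_) ≡.isEquivalence)
  λ { (lift x∼y) → Pointwise.inj₁ (EqClosure.return x∼y) }

withIsolated-lift : ∀ {x y} → EqClosure _∼_ x y →
  EqClosure (WithIsolated _∼_ I) (inj₁ x) (inj₁ y)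
withIsolated-lift = EqClosure.gmap inj₁ lift

withIsolated⁺ : NumClasses _∼_ k → NumClasses (WithIsolated _∼_ (Fin m)) (k + m)
withIsolated⁺ {_∼_ = _∼_} {k = k} {m = m} (h , onto , classes) =
  h⁺ , onto⁺ , λ x y → cls⇒ x y , cls⇐
  where
  h⁺ : _ ⊎ Fin m → Fin (k + m)
  h⁺ = join k m ∘ Sum.map₁ h
  rejoin : ∀ {c z} → splitAt k c ≡ z → join k m z ≡ c
  rejoin {c} eq = trans (cong (join k m) (sym eq)) (join-splitAt k m c)
  onto⁺ : ∀ c → ∃ λ z → h⁺ z ≡ c
  onto⁺ c with splitAt k c in eq
  ... | inj₁ c′ = inj₁ (proj₁ (onto c′)) , trans (cong (λ c″ → join k m (inj₁ c″)) (proj₂ (onto c′))) (rejoin eq)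
  ... | inj₂ i  = inj₂ i , rejoin eq
  cls⇒ : ∀ x y → h⁺ x ≡ h⁺ y → EqClosure (WithIsolated _∼_ (Fin m)) x y
  cls⇒ x y eq = separate x y (trans (sym (split x)) (trans (cong (splitAt k) eq) (split y)))
    where
    split : ∀ x → splitAt k (h⁺ x) ≡ Sum.map₁ h x
    split x = splitAt-join k m (Sum.map₁ h x)
    separate : ∀ x y → Sum.map₁ h x ≡ Sum.map₁ h y → EqClosure (WithIsolated _∼_ (Fin m)) x y
    separate (inj₁ a) (inj₁ b) eq = withIsolated-lift (proj₁ (classes a b) (inj₁-injective eq))
    separate (inj₂ i) (inj₂ .i) refl = ε
  cls⇐ : ∀ {x y} → EqClosure (WithIsolated _∼_ (Fin m)) x y → h⁺ x ≡ h⁺ y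
  cls⇐ x∼y with withIsolated-classes x∼y
  ... | Pointwise.inj₁ a∼b = cong (λ c → join k m (inj₁ c)) (proj₂ (classes _ _) a∼b)
  ... | Pointwise.inj₂ refl = refl

private
  withIsolated-emptyEquivalence : ClassEquivalence (WithIsolated _∼_ (Fin 0)) _∼_
  withIsolated-emptyEquivalence = record
    { to = Sum.[ id , (λ ()) ] ; from = inj₁
    ; to-cong = λ { (lift x∼y) → EqClosure.return x∼y } ; from-cong = EqClosure.return ∘ lift
    ; from∘to = λ { (inj₁ _) → ε } ; to∘from = λ _ → ε }

  withIsolated-dropOne : ∀ {k′} → NumClasses (WithIsolated _∼_ (Fin (suc m))) k′ →
    ∃ λ k → k′ ≡ suc k × NumClasses (WithIsolated _∼_ (Fin m)) k
  withIsolated-dropOne {k′ = zero} (h , _) with h (inj₂ zero)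
  ... | ()
  withIsolated-dropOne {_∼_ = _∼_} {m = m} {k′ = suc k} (h , onto , classes) =
    k , refl , h′ , onto′ , λ x y → cls⇒ x y , cls⇐
    where
    c₀ = h (inj₂ zero)
    embed : _ ⊎ Fin m → _ ⊎ Fin (suc m)
    embed = Sum.map₂ suc
    unembed : ∀ x y → EqClosure (WithIsolated _∼_ (Fin (suc m))) (embed x) (embed y) →
      EqClosure (WithIsolated _∼_ (Fin m)) x y
    unembed (inj₁ a) (inj₁ b) x∼y with withIsolated-classes x∼y
    ... | Pointwise.inj₁ a∼b = withIsolated-lift a∼b
    unembed (inj₂ i) (inj₂ j) x∼y with withIsolated-classes x∼y
    ... | Pointwise.inj₂ refl = ε
    unembed (inj₁ a) (inj₂ j) x∼y with withIsolated-classes x∼y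
    ... | ()
    unembed (inj₂ i) (inj₁ b) x∼y with withIsolated-classes x∼y
    ... | ()
    apart : ∀ z → c₀ ≢ h (embed z)
    apart z eq with z | withIsolated-classes (proj₁ (classes (inj₂ zero) (embed z)) eq)
    ... | inj₁ _ | ()
    ... | inj₂ _ | Pointwise.inj₂ ()
    h′ : _ ⊎ Fin m → Fin k
    h′ z = punchOut (apart z)
    onto′ : ∀ c → ∃ λ z → h′ z ≡ c
    onto′ c with onto (punchIn c₀ c)
    ... | inj₂ zero , eq = ⊥-elim (punchInᵢ≢i c₀ c (sym eq))
    ... | inj₁ a , eq = inj₁ a , trans (punchOut-cong c₀ eq) (punchOut-punchIn c₀)
    ... | inj₂ (suc i) , eq = inj₂ i , trans (punchOut-cong c₀ eq) (punchOut-punchIn c₀)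
    cls⇒ : ∀ x y → h′ x ≡ h′ y → EqClosure (WithIsolated _∼_ (Fin m)) x y
    cls⇒ x y eq = unembed x y (proj₁ (classes _ _) (punchOut-injective (apart x) (apart y) eq))
    cls⇐ : ∀ {x y} → EqClosure (WithIsolated _∼_ (Fin m)) x y → h′ x ≡ h′ y
    cls⇐ x∼y = punchOut-cong c₀ (proj₂ (classes _ _)
      (EqClosure.gmap embed (λ { (lift a∼b) → lift a∼b }) x∼y))

withIsolated⁻ : ∀ {k′} → NumClasses (WithIsolated _∼_ (Fin m)) k′ →
  ∃ λ k → k′ ≡ k + m × NumClasses _∼_ k
withIsolated⁻ {m = zero} {k′ = k′} classes =
  k′ , sym (+-identityʳ k′) , numClasses-transport withIsolated-emptyEquivalence classes
withIsolated⁻ {m = suc m} classes with withIsolated-dropOne classes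
... | k₁ , refl , classes₁ with withIsolated⁻ classes₁
... | k , refl , classes₂ = k , sym (+-suc k m) , classes₂

-- k elements are k classes of the empty relation, so that counts of
-- elements can be traded like counts of classes.
module _ {A : Set} where
  private
    discrete-classes : ∀ {x y} → EqClosure (Never {A = A}) x y → x ≡ y
    discrete-classes = EqClosure-respects id λ ()

  ↔⇒numClasses : Fin k ↔ A → NumClasses (Never {A = A}) k
  ↔⇒numClasses F = from , (λ c → to c , strictlyInverseʳ c) , λ x y →
    (λ eq → ≡⇒EqClosure (trans (sym (strictlyInverseˡ x)) (trans (cong to eq) (strictlyInverseˡ y)))) ,
    cong from ∘ discrete-classes
    where open Inverse F

  numClasses⇒↔ : NumClasses (Never {A = A}) k → Fin k ↔ A
  numClasses⇒↔ (h , onto , classes) = mk↔ₛ′ (proj₁ ∘ onto) h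
    (λ x → discrete-classes (proj₁ (classes _ _) (proj₂ (onto (h x))))) (proj₂ ∘ onto)

discrete-⊎ : ClassEquivalence (Never {A = A ⊎ I}) (WithIsolated (Never {A = A}) I)
discrete-⊎ = record
  { to = id ; from = id ; to-cong = λ () ; from-cong = λ { (lift ()) }
  ; from∘to = λ _ → ε ; to∘from = λ _ → ε }

count-exchange : ∀ {Z} a b → A ↔ (Z ⊎ Fin a) → B ↔ (Z ⊎ Fin b) →
  ∀ {n} → Fin n ↔ A → ∃ λ m → (Fin m ↔ B) × (n + b ≡ m + a)
count-exchange a b A↔ B↔ n↔A
  with withIsolated⁻ (numClasses-transport discrete-⊎ (↔⇒numClasses (↔-trans n↔A A↔)))
... | z , refl , countZ =
  z + b ,
  ↔-trans (numClasses⇒↔ (numClasses-transport (ClassEquivalence-sym discrete-⊎) (withIsolated⁺ countZ)))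
          (↔-sym B↔) ,
  trans (+-assoc z a b) (trans (cong (λ w → z + w) (+-comm a b)) (sym (+-assoc z b a)))

bit : Bool → ℕ
bit false = 0
bit true  = 1

count : ∀ {n} → (Fin n → Bool) → ℕ
count {zero}  p = 0
count {suc n} p = bit (p zero) + count (p ∘ suc)

Σ-⊎-↔ : {P : A ⊎ B → Set} → Σ (A ⊎ B) P ↔ (Σ A (P ∘ inj₁) ⊎ Σ B (P ∘ inj₂))
Σ-⊎-↔ = mk↔ₛ′
  (λ { (inj₁ a , p) → inj₁ (a , p) ; (inj₂ b , p) → inj₂ (b , p) })
  (λ { (inj₁ (a , p)) → inj₁ a , p ; (inj₂ (b , p)) → inj₂ b , p })
  (λ { (inj₁ _) → refl ; (inj₂ _) → refl })
  (λ { (inj₁ _ , _) → refl ; (inj₂ _ , _) → refl })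

T↔bit : ∀ b → T b ↔ Fin (bit b)
T↔bit false = mk↔ₛ′ (λ ()) (λ ()) (λ ()) (λ ())
T↔bit true  = mk↔ₛ′ (λ _ → zero) (λ _ → tt) (λ { zero → refl }) (λ _ → refl)

count-↔ : ∀ {n} (p : Fin n → Bool) → Σ (Fin n) (T ∘ p) ↔ Fin (count p)
count-↔ {zero}  p = mk↔ₛ′ (λ ()) (λ ()) (λ ()) (λ ())
count-↔ {suc n} p =
  ↔-trans Σ-Fin-suc (↔-trans (T↔bit (p zero) ⊎-↔ count-↔ (p ∘ suc)) (↔-sym +↔⊎))
  where
  Σ-Fin-suc : Σ (Fin (suc n)) (T ∘ p) ↔ (T (p zero) ⊎ Σ (Fin n) (T ∘ p ∘ suc))
  Σ-Fin-suc = mk↔ₛ′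
    (λ { (zero , q) → inj₁ q ; (suc i , q) → inj₂ (i , q) })
    (λ { (inj₁ q) → zero , q ; (inj₂ (i , q)) → suc i , q })
    (λ { (inj₁ _) → refl ; (inj₂ _) → refl })
    (λ { (zero , _) → refl ; (suc _ , _) → refl })

-- Isomorphic graphs have the same degree

record _≅_ (G H : MOGraph) : Set where
  module G = MOGraph G
  module H = MOGraph H
  field
    to      : G.Vtx → H.Vtx
    from    : H.Vtx → G.Vtx
    from∘to : ∀ x → from (to x) ≡ x
    to∘from : ∀ y → to (from y) ≡ y
    kind-to : ∀ x → H.kind (to x) ≡ G.kind x
    out-to  : ∀ x i → H.out (to x , i) ≡ G.out (x , i)
    α-to    : ∀ x i → H.α (to x , i) ≡ map₁ to (G.α (x , i))

≅-sym : ∀ {G H} → G ≅ H → H ≅ G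
≅-sym {G} {H} G≅H = record
  { to = from ; from = to ; from∘to = to∘from ; to∘from = from∘to
  ; kind-to = λ y → trans (sym (kind-to (from y))) (cong H.kind (to∘from y))
  ; out-to = λ y i → trans (sym (out-to (from y) i)) (cong (λ z → H.out (z , i)) (to∘from y))
  ; α-to = λ y i → begin
      G.α (from y , i)                          ≡⟨ map₁-from∘to (G.α (from y , i)) ⟩
      map₁ from (map₁ to (G.α (from y , i)))     ≡⟨ cong (map₁ from) (sym (α-to (from y) i)) ⟩
      map₁ from (H.α (to (from y) , i))          ≡⟨ cong (λ z → map₁ from (H.α (z , i))) (to∘from y) ⟩
      map₁ from (H.α (y , i))                    ∎ }
  where
  open _≅_ G≅H
  open ≡-Reasoning
  map₁-from∘to : ∀ h → h ≡ map₁ from (map₁ to h)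
  map₁-from∘to (x , i) = cong (_, i) (sym (from∘to x))

private
  module ≅-Maps {G H : MOGraph} (G≅H : G ≅ H) where
    open _≅_ G≅H

    toEnd : StrandEnd G → StrandEnd H
    toEnd (h , t) = map₁ to h , t

    adjacent-to : ∀ {x y} → Adjacent G x y → Adjacent H (to x) (to y)
    adjacent-to {x} (i , j , eq) = i , j , trans (α-to x i) (cong (map₁ to) eq)

    strandStep-to : ∀ {e e′} → StrandStep G e e′ → StrandStep H (toEnd e) (toEnd e′)
    strandStep-to {(x , i) , t} (inj₁ refl) = inj₁ (cong (_, t) (sym (α-to x i)))
    strandStep-to {(x , i) , t} (inj₂ refl) =
      inj₂ (cong₂ (λ k o → (to x , route k o i t) , t) (sym (kind-to x)) (sym (out-to x i)))

    ofKind-to : ∀ p → Σ G.Vtx (T ∘ p ∘ G.kind) → Σ H.Vtx (T ∘ p ∘ H.kind)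
    ofKind-to p (x , px) = to x , subst (T ∘ p) (sym (kind-to x)) px

module _ {G H : MOGraph} (G≅H : G ≅ H) where
  open _≅_ G≅H
  private
    H≅G = ≅-sym G≅H

  adjacent-≅ : ClassEquivalence (Adjacent G) (Adjacent H)
  adjacent-≅ = record
    { to = to ; from = from
    ; to-cong = EqClosure.return ∘ ≅-Maps.adjacent-to G≅H
    ; from-cong = EqClosure.return ∘ ≅-Maps.adjacent-to H≅G
    ; from∘to = ≡⇒EqClosure ∘ from∘to ; to∘from = ≡⇒EqClosure ∘ to∘from }

  strandStep-≅ : ClassEquivalence (StrandStep G) (StrandStep H)
  strandStep-≅ = record
    { to = ≅-Maps.toEnd G≅H ; from = ≅-Maps.toEnd H≅G
    ; to-cong = EqClosure.return ∘ ≅-Maps.strandStep-to G≅H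
    ; from-cong = EqClosure.return ∘ ≅-Maps.strandStep-to H≅G
    ; from∘to = λ { ((x , i) , t) → ≡⇒EqClosure (cong (λ z → (z , i) , t) (from∘to x)) }
    ; to∘from = λ { ((y , i) , t) → ≡⇒EqClosure (cong (λ z → (z , i) , t) (to∘from y)) } }

  ofKind-≅ : ∀ p → Σ G.Vtx (T ∘ p ∘ G.kind) ↔ Σ H.Vtx (T ∘ p ∘ H.kind)
  ofKind-≅ p = mk↔ₛ′ (≅-Maps.ofKind-to G≅H p) (≅-Maps.ofKind-to H≅G p)
    (λ (y , _) → Σ-≡,≡→≡ (to∘from y , T-irrelevant _ _))
    (λ (x , _) → Σ-≡,≡→≡ (from∘to x , T-irrelevant _ _))

  twiceDegree-≅ : ∀ {d} → HasTwiceDegree G d → HasTwiceDegree H d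
  twiceDegree-≅ (c , nV , nF , nU , nB , comps , stds , faces , unb , brk , eq) =
    c , nV , nF , nU , nB ,
    numClasses-transport adjacent-≅ comps , ↔-trans stds (ofKind-≅ isStd) ,
    numClasses-transport strandStep-≅ faces , ↔-trans unb (ofKind-≅ isUnbroken) ,
    ↔-trans brk (ofKind-≅ isBroken) , eq

record SameTwiceDegree (G H : MOGraph) : Set where
  field
    at : ∀ d → (HasTwiceDegree G d → HasTwiceDegree H d) × (HasTwiceDegree H d → HasTwiceDegree G d)

sameTwiceDegree-trans : ∀ {G H J} → SameTwiceDegree G H → SameTwiceDegree H J → SameTwiceDegree G J
sameTwiceDegree-trans G∼H H∼J .SameTwiceDegree.at d =
  proj₁ (H∼J .SameTwiceDegree.at d) ∘ proj₁ (G∼H .SameTwiceDegree.at d) ,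
  proj₂ (G∼H .SameTwiceDegree.at d) ∘ proj₂ (H∼J .SameTwiceDegree.at d)

≅⇒sameTwiceDegree : ∀ {G H} → G ≅ H → SameTwiceDegree G H
≅⇒sameTwiceDegree G≅H .SameTwiceDegree.at d = twiceDegree-≅ G≅H , twiceDegree-≅ (≅-sym G≅H)

-- Replacing a vertex by a gadget

data Link (n : ℕ) : Set where
  inside  : Fin n → Fin 4 → Link n
  outside : Fin 4 → Link n

-- Like the vertices of dipoles and chain-vertices, the vertices of a gadget
-- have their outgoing half-edges at the even slots.  The half-edge
-- port j takes the place of slot j of the replaced vertex.
record Gadget : Set where
  field
    size : ℕ
    kind : Fin size → Kind
    link : Fin size → Fin 4 → Link size
    port : Fin 4 → Fin size × Fin 4

module Replacement (G : MOGraph) (v : MOGraph.Vtx G) (Γ : Gadget) where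
  open MOGraph G
  open Gadget Γ renaming (kind to kindΓ)

  Old : Set
  Old = Σ Vtx λ x → False (x ≟V v)

  Vtx′ : Set
  Vtx′ = Old ⊎ Fin size

  old : (x : Vtx) → x ≢ v → Vtx′
  old x x≢v = inj₁ (x , fromWitnessFalse x≢v)

  resolveAt : (h : Vtx × Fin 4) → Dec (proj₁ h ≡ v) → Vtx′ × Fin 4
  resolveAt (_ , j) (yes _)  = map₁ inj₂ (port j)
  resolveAt (x , j) (no x≢v) = old x x≢v , j

  resolve : Vtx × Fin 4 → Vtx′ × Fin 4
  resolve h = resolveAt h (proj₁ h ≟V v)

  linkHalfEdge : Link size → Vtx′ × Fin 4
  linkHalfEdge (inside b k) = inj₂ b , k
  linkHalfEdge (outside j)  = resolve (α (v , j))

  graph : MOGraph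
  graph = record
    { Vtx  = Vtx′
    ; _≟V_ = ⊎-≡-dec (Σ-≡-dec _≟V_ λ p q → yes (T-irrelevant p q)) _≟F_
    ; kind = Sum.[ kind ∘ proj₁ , kindΓ ]
    ; α    = λ { (inj₁ (x , _) , k) → resolve (α (x , k)) ; (inj₂ a , k) → linkHalfEdge (link a k) }
    ; out  = λ { (inj₁ (x , _) , k) → out (x , k) ; (inj₂ _ , k) → evenSlot k }
    }

  resolve-v : ∀ j → resolve (v , j) ≡ map₁ inj₂ (port j)
  resolve-v j with v ≟V v
  ... | yes _   = refl
  ... | no v≢v  = ⊥-elim (v≢v refl)

  resolve-old : ∀ x (x≢v : False (x ≟V v)) j → resolve (x , j) ≡ (inj₁ (x , x≢v) , j)
  resolve-old x x≢v j = resolveAt-old (x ≟V v)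
    where
    resolveAt-old : (d : Dec (x ≡ v)) → resolveAt (x , j) d ≡ (inj₁ (x , x≢v) , j)
    resolveAt-old (yes x≡v) = ⊥-elim (toWitnessFalse x≢v x≡v)
    resolveAt-old (no _)    = cong (λ p → inj₁ (x , p) , j) (T-irrelevant _ _)

replace : (G : MOGraph) → MOGraph.Vtx G → Gadget → MOGraph
replace G v Γ = Replacement.graph G v Γ

-- Strands inside a gadget and labellings of its faces

_≟Ty_ : DecidableEquality Ty
L ≟Ty L = yes refl
L ≟Ty S = no λ ()
L ≟Ty R = no λ ()
S ≟Ty L = no λ ()
S ≟Ty S = yes refl
S ≟Ty R = no λ ()
R ≟Ty L = no λ ()
R ≟Ty S = no λ ()
R ≟Ty R = yes refl

module GadgetStrands (Γ : Gadget) where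
  open Gadget Γ

  End : Set
  End = Fin size × Fin 4 × Ty

  _≟E_ : DecidableEquality End
  _≟E_ = Σ-≡-dec _≟F_ (Σ-≡-dec _≟F_ _≟Ty_)

  turn : End → End
  turn (a , i , t) = a , route (kind a) (evenSlot i) i t , t

  boundaryEnd : Fin 4 → Ty → End
  boundaryEnd j t = proj₁ (port j) , proj₂ (port j) , t

  -- a face of the gadget is named by one of its exits, or by a representative if it is closed
  Label : Set
  Label = (Fin 4 × Ty) ⊎ End

record Labelling (Γ : Gadget) : Set where
  open GadgetStrands Γ
  field
    K              : ℕ
    label          : End → Label
    representative : Fin K → End
    index          : End → Maybe (Fin K)

-- Nothing is proved about this search: the checks below validate its result.
module FaceSearch (Γ : Gadget) where
  open Gadget Γ
  open GadgetStrands Γ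

  private
    _==_ : End → End → Bool
    e == e′ = ⌊ e ≟E e′ ⌋

    -- follows the strand of the face from e, turning first: either the
    -- ends met before returning to e, or the exit through which it leaves
    trace : ℕ → End → End → List End ⊎ Fin 4
    trace zero    _  _           = inj₁ []
    trace (suc f) e₀ (a , i , t) = continue (link a i′)
      where
      i′ = route (kind a) (evenSlot i) i t
      continue : Link size → List End ⊎ Fin 4
      continue (outside j)  = inj₂ j
      continue (inside b k) = Sum.map₁ (λ ends → (a , i , t) ∷ (a , i′ , t) ∷ ends)
        (if (b , k , t) == e₀ then inj₁ [] else trace f e₀ (b , k , t))

    fuel : ℕ
    fuel = 12 * size

    exitBehind : End → Fin 4
    exitBehind (a , i , t) with link a i
    ... | outside j = j
    ... | inside b k = Sum.[ (λ _ → i) , id ] (trace fuel (b , k , t) (b , k , t))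

    code : End → ℕ
    code (a , i , t) = toℕ a * 12 + toℕ i * 3 + tyCode t
      where
      tyCode : Ty → ℕ
      tyCode L = 0
      tyCode S = 1
      tyCode R = 2

    least : End → List End → End
    least = foldr λ e m → if code e <ᵇ code m then e else m

    earlier : Fin 4 → Fin 4 → Fin 4
    earlier j j′ = if toℕ j <ᵇ toℕ j′ then j else j′

    -- the same for all ends of a face: the least end of a closed face,
    -- the smaller exit of an open one
    label : End → Label
    label e@(_ , _ , t) =
      Sum.[ (λ ends → inj₂ (least e ends)) , (λ j → inj₁ (earlier j (exitBehind e) , t)) ]
        (trace fuel e e)

    representatives : List End
    representatives = filterᵇ (λ e → Sum.[ (λ _ → false) , _== e ] (label e))
      (cartesianProduct (allFin size) (cartesianProduct (allFin 4) (L ∷ S ∷ R ∷ [])))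

  faceLabelling : Labelling Γ
  faceLabelling = record
    { K              = length representatives
    ; label          = label
    ; representative = List.lookup representatives
    ; index          = λ r → findIndexᵇ (r ==_) representatives
    }

-- Checking a labelling by evaluation

∧-split : ∀ {x y} → T (x ∧ y) → T x × T y
∧-split = Equivalence.to T-∧

∨-split : ∀ x {y} → T (x ∨ y) → T x ⊎ T y
∨-split true  _ = inj₁ tt
∨-split false p = inj₂ p

allᵇ : ∀ {n} → (Fin n → Bool) → Bool
allᵇ p = ⌊ all? (T? ∘ p) ⌋

anyᵇ : ∀ {n} → (Fin n → Bool) → Bool
anyᵇ p = ⌊ any? (T? ∘ p) ⌋

allTyᵇ : (Ty → Bool) → Bool
allTyᵇ p = p L ∧ p S ∧ p R

allTyᵇ-sound : ∀ p → T (allTyᵇ p) → ∀ t → T (p t)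
allTyᵇ-sound p ok L = proj₁ (∧-split {p L} ok)
allTyᵇ-sound p ok S = proj₁ (∧-split {p S} (proj₂ (∧-split {p L} ok)))
allTyᵇ-sound p ok R = proj₂ (∧-split {p S} (proj₂ (∧-split {p L} ok)))

weight : ℕ → ℕ → ℕ → ℕ
weight nV nU nB = 3 * nV + 4 * nU + 6 * nB

kindWeight : Kind → ℕ
kindWeight k = weight (bit (isStd k)) (bit (isUnbroken k)) (bit (isBroken k))

data ChainKind : Set where
  cL cR cSe cSo cB : ChainKind

toKind : ChainKind → Kind
toKind cL  = chL
toKind cR  = chR
toKind cSe = chSe
toKind cSo = chSo
toKind cB  = chB

route-orientationFree : ∀ k b j t → route (toKind k) b j t ≡ route (toKind k) true j t
route-orientationFree cL  _ _ L = refl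
route-orientationFree cL  _ _ S = refl
route-orientationFree cL  _ _ R = refl
route-orientationFree cR  _ _ L = refl
route-orientationFree cR  _ _ S = refl
route-orientationFree cR  _ _ R = refl
route-orientationFree cSe _ _ L = refl
route-orientationFree cSe _ _ S = refl
route-orientationFree cSe _ _ R = refl
route-orientationFree cSo _ _ L = refl
route-orientationFree cSo _ _ S = refl
route-orientationFree cSo _ _ R = refl
route-orientationFree cB  _ _ _ = refl

module Checks {Γ : Gadget} (Λ : Labelling Γ) (κ : ChainKind) where
  open Gadget Γ
  open GadgetStrands Γ
  open Labelling Λ

  routeV : Fin 4 → Ty → Fin 4
  routeV j t = route (toKind κ) true j t

  allEndᵇ : (End → Bool) → Bool
  allEndᵇ p = allᵇ λ a → allᵇ λ i → allTyᵇ λ t → p (a , i , t)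

  allEndᵇ-sound : ∀ p → T (allEndᵇ p) → ∀ e → T (p e)
  allEndᵇ-sound p ok (a , i , t) = allTyᵇ-sound (λ t → p (a , i , t)) (toWitness (toWitness ok a) i) t

  -- Two exits of the gadget are on one face of G when the strand through v joins them.
  sameFace : Label → Label → Bool
  sameFace (inj₁ (j , t)) (inj₁ (j′ , t′)) =
    ⌊ t ≟Ty t′ ⌋ ∧ (⌊ j ≟F j′ ⌋ ∨ ⌊ routeV j t ≟F j′ ⌋)
  sameFace (inj₂ r)       (inj₂ r′)        = ⌊ r ≟E r′ ⌋
  sameFace _              _                = false

  labelAcross : Ty → Link size → Label
  labelAcross t (inside b k) = label (b , k , t)
  labelAcross t (outside j)  = inj₁ (j , t)

  leadsOutside : Link size → Fin 4 → Bool
  leadsOutside (inside _ _) j = false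
  leadsOutside (outside j′) j = ⌊ j′ ≟F j ⌋

  represented : Label → Bool
  represented (inj₁ _) = true
  represented (inj₂ r) = maybe′ (λ c → ⌊ representative c ≟E r ⌋) false (index r)

  indexes : Fin K → Label → Bool
  indexes c (inj₁ _) = false
  indexes c (inj₂ r) = maybe′ (λ c′ → ⌊ c′ ≟F c ⌋) false (index r)

  target : Label → End
  target (inj₁ (j , t)) = boundaryEnd j t
  target (inj₂ r)       = r

  -- does the strand from e, turning first (true) or crossing first (false), meet e′?
  meets : ℕ → Bool → End → End → Bool
  meetsAcross : ℕ → Ty → End → Link size → Bool
  meets zero    _     _ _  = false
  meets (suc f) true  e e′ = ⌊ e ≟E e′ ⌋ ∨ meets f false (turn e) e′
  meets (suc f) false (a , i , t) e′ = ⌊ (a , i , t) ≟E e′ ⌋ ∨ meetsAcross f t e′ (link a i)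
  meetsAcross f t e′ (inside b k) = meets f true (b , k , t) e′
  meetsAcross f t e′ (outside _)  = false

  fuel : ℕ
  fuel = suc (12 * size)

  connected : End → End → Bool
  connected e e′ = meets fuel true e e′ ∨ meets fuel false e e′

  root : Fin size
  root = proj₁ (port zero)

  reachesRoot : ℕ → Fin size → Bool
  reachesAcross : ℕ → Link size → Bool
  reachesRoot zero    a = ⌊ a ≟F root ⌋
  reachesRoot (suc f) a = ⌊ a ≟F root ⌋ ∨ anyᵇ (reachesAcross f ∘ link a)
  reachesAcross f (inside b _) = reachesRoot f b
  reachesAcross f (outside _)  = false

  portLeadsOutside : Fin 4 → Bool
  portLeadsOutside j = leadsOutside (uncurry link (port j)) j

  portLabelled : Fin 4 → Ty → Bool
  portLabelled j t = sameFace (label (boundaryEnd j t)) (inj₁ (j , t))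

  turnConsistent : End → Bool
  turnConsistent e = sameFace (label e) (label (turn e))

  linkConsistent : End → Bool
  linkConsistent (a , i , t) = sameFace (label (a , i , t)) (labelAcross t (link a i))

  closedRepresented : End → Bool
  closedRepresented e = represented (label e)

  representativeIndexed : Fin K → Bool
  representativeIndexed c = indexes c (label (representative c))

  labelReached : End → Bool
  labelReached e = connected e (target (label e))

  routeReached : Fin 4 → Ty → Bool
  routeReached j t = connected (boundaryEnd j t) (boundaryEnd (routeV j t) t)

  portsOutside portLabels turnLabels linkLabels closedIndexed representativesIndexed
    labelsConnected routesConnected gadgetConnected weightBalance : Bool
  portsOutside = allᵇ portLeadsOutside
  portLabels   = allᵇ λ j → allTyᵇ (portLabelled j)
  turnLabels   = allEndᵇ turnConsistent
  linkLabels   = allEndᵇ linkConsistent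
  closedIndexed = allEndᵇ closedRepresented
  representativesIndexed = allᵇ representativeIndexed
  labelsConnected = allEndᵇ labelReached
  routesConnected = allᵇ λ j → allTyᵇ (routeReached j)
  gadgetConnected = allᵇ (reachesRoot size)
  weightBalance = weight (count (isStd ∘ kind)) (count (isUnbroken ∘ kind)) (count (isBroken ∘ kind))
                    ≡ᵇ kindWeight (toKind κ) + 2 * K

  valid : Bool
  valid = portsOutside ∧ portLabels ∧ turnLabels ∧ linkLabels ∧ closedIndexed ∧ representativesIndexed
        ∧ labelsConnected ∧ routesConnected ∧ gadgetConnected ∧ weightBalance

  record Valid : Set where
    field
      ports-outside    : ∀ j → T (portLeadsOutside j)
      port-labels      : ∀ j t → T (portLabelled j t)
      turn-labels      : ∀ e → T (turnConsistent e)
      link-labels      : ∀ e → T (linkConsistent e)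
      closed-indexed   : ∀ e → T (closedRepresented e)
      representatives-indexed : ∀ c → T (representativeIndexed c)
      labels-connected : ∀ e → T (labelReached e)
      routes-connected : ∀ j t → T (routeReached j t)
      gadget-connected : ∀ a → T (reachesRoot size a)
      weight-balance   : weight (count (isStd ∘ kind)) (count (isUnbroken ∘ kind))
                                (count (isBroken ∘ kind))
                           ≡ kindWeight (toKind κ) + 2 * K

  valid⇒Valid : T valid → Valid
  valid⇒Valid ok =
    let ok₁ , ok = ∧-split {portsOutside} ok
        ok₂ , ok = ∧-split {portLabels} ok
        ok₃ , ok = ∧-split {turnLabels} ok
        ok₄ , ok = ∧-split {linkLabels} ok
        ok₅ , ok = ∧-split {closedIndexed} ok
        ok₆ , ok = ∧-split {representativesIndexed} ok
        ok₇ , ok = ∧-split {labelsConnected} ok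
        ok₈ , ok = ∧-split {routesConnected} ok
        ok₉ , ok₁₀ = ∧-split {gadgetConnected} ok
    in record
    { ports-outside    = toWitness ok₁
    ; port-labels      = λ j → allTyᵇ-sound (portLabelled j) (toWitness ok₂ j)
    ; turn-labels      = allEndᵇ-sound turnConsistent ok₃
    ; link-labels      = allEndᵇ-sound linkConsistent ok₄
    ; closed-indexed   = allEndᵇ-sound closedRepresented ok₅
    ; representatives-indexed = toWitness ok₆
    ; labels-connected = allEndᵇ-sound labelReached ok₇
    ; routes-connected = λ j → allTyᵇ-sound (routeReached j) (toWitness ok₈ j)
    ; gadget-connected = toWitness ok₉
    ; weight-balance   = ≡ᵇ⇒≡ _ _ ok₁₀
    }

-- A valid gadget does not change the degree

private
  regroup : ∀ c a b d x y z →
    6 * c + 3 * a + 4 * b + 6 * d + (3 * x + 4 * y + 6 * z) ≡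
    6 * c + 3 * (a + x) + 4 * (b + y) + 6 * (d + z)
  regroup = solve-∀

  reorder : ∀ X W K → X + (W + 2 * K) ≡ 2 * K + X + W
  reorder = solve-∀

twiceDegree-exchange : ∀ c nF nV nU nB nV′ nU′ nB′ s u b s′ u′ b′ K →
  nV + s′ ≡ nV′ + s → nU + u′ ≡ nU′ + u → nB + b′ ≡ nB′ + b →
  weight s′ u′ b′ ≡ weight s u b + 2 * K →
  + (6 * c + 3 * nV′ + 4 * nU′ + 6 * nB′) - + (2 * (nF + K)) ≡
  + (6 * c + 3 * nV + 4 * nU + 6 * nB) - + (2 * nF)
twiceDegree-exchange c nF nV nU nB nV′ nU′ nB′ s u b s′ u′ b′ K eV eU eB eW = begin
  + X′ - + (2 * (nF + K))             ≡⟨ cong₂ (λ x y → + x - + y) X′≡2K+X 2[nF+K]≡2K+2nF ⟩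
  + (2 * K + X) - + (2 * K + 2 * nF)  ≡⟨ [+m]-[+n]≡m⊖n (2 * K + X) (2 * K + 2 * nF) ⟩
  (2 * K + X) ⊖ (2 * K + 2 * nF)      ≡⟨ +-cancelˡ-⊖ (2 * K) X (2 * nF) ⟩
  X ⊖ (2 * nF)                        ≡⟨ sym ([+m]-[+n]≡m⊖n X (2 * nF)) ⟩
  + X - + (2 * nF)                    ∎
  where
  open ≡-Reasoning
  X  = 6 * c + 3 * nV + 4 * nU + 6 * nB
  X′ = 6 * c + 3 * nV′ + 4 * nU′ + 6 * nB′
  W  = weight s u b
  cong₃ : ∀ {a a′ b b′ d d′} → a ≡ a′ → b ≡ b′ → d ≡ d′ →
    6 * c + 3 * a + 4 * b + 6 * d ≡ 6 * c + 3 * a′ + 4 * b′ + 6 * d′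
  cong₃ refl refl refl = refl
  2[nF+K]≡2K+2nF : 2 * (nF + K) ≡ 2 * K + 2 * nF
  2[nF+K]≡2K+2nF = trans (*-distribˡ-+ 2 nF K) (+-comm (2 * nF) (2 * K))
  X′≡2K+X : X′ ≡ 2 * K + X
  X′≡2K+X = +-cancelʳ-≡ W X′ (2 * K + X) (begin
    X′ + W                                                  ≡⟨ regroup c nV′ nU′ nB′ s u b ⟩
    6 * c + 3 * (nV′ + s) + 4 * (nU′ + u) + 6 * (nB′ + b)   ≡⟨ cong₃ (sym eV) (sym eU) (sym eB) ⟩
    6 * c + 3 * (nV + s′) + 4 * (nU + u′) + 6 * (nB + b′)   ≡⟨ sym (regroup c nV nU nB s′ u′ b′) ⟩
    X + weight s′ u′ b′                                     ≡⟨ cong (λ w → X + w) eW ⟩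
    X + (W + 2 * K)                                         ≡⟨ reorder X W K ⟩
    2 * K + X + W                                           ∎)

module Soundness (G : MOGraph) (v : MOGraph.Vtx G) {Γ : Gadget} (Λ : Labelling Γ) {κ : ChainKind}
                 (v-kind : MOGraph.kind G v ≡ toKind κ) (checked : Checks.Valid Λ κ) where
  open MOGraph G
  open Gadget Γ renaming (kind to kindΓ)
  open GadgetStrands Γ
  open Labelling Λ
  open Checks Λ κ
  open Valid checked
  open Replacement G v Γ

  private
    H : MOGraph
    H = graph

    kv : Kind
    kv = toKind κ

  routeAtV : ∀ j t → route (kind v) (out (v , j)) j t ≡ routeV j t
  routeAtV j t = trans (cong (λ k → route k (out (v , j)) j t) v-kind)
                       (route-orientationFree κ _ j t)

  port-α : ∀ j → MOGraph.α H (map₁ inj₂ (port j)) ≡ resolve (α (v , j))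
  port-α j = leadsOutside-sound (uncurry link (port j)) (ports-outside j)
    where
    leadsOutside-sound : ∀ l → T (leadsOutside l j) → linkHalfEdge l ≡ resolve (α (v , j))
    leadsOutside-sound (outside j′) j′≡j rewrite toWitness j′≡j = refl

  -- A face of H avoids the gadget, passes through it like a face of G
  -- through v, or is one of the K faces closed up inside it.
  Faces : Rel (StrandEnd G ⊎ Fin K) 0ℓ
  Faces = WithIsolated (StrandStep G) (Fin K)

  end : End → StrandEnd H
  end (a , i , t) = (inj₂ a , i) , t

  faceOf : Label → StrandEnd G ⊎ Fin K
  faceOf (inj₁ (j , t)) = inj₁ ((v , j) , t)
  -- the default for a missing index is junk, excluded by closed-indexed
  faceOf (inj₂ r@(_ , i , t)) = maybe′ inj₂ (inj₁ ((v , i) , t)) (index r)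

  toFaces : StrandEnd H → StrandEnd G ⊎ Fin K
  toFaces ((inj₁ (x , _) , i) , t) = inj₁ ((x , i) , t)
  toFaces ((inj₂ a , i) , t)       = faceOf (label (a , i , t))

  fromFaces : StrandEnd G ⊎ Fin K → StrandEnd H
  fromFaces (inj₁ (h , t)) = resolve h , t
  fromFaces (inj₂ c)       = end (representative c)

  boundary-sound : ∀ j j′ {t t′} → t ≡ t′ →
    T (⌊ j ≟F j′ ⌋ ∨ ⌊ routeV j t ≟F j′ ⌋) →
    EqClosure Faces (inj₁ ((v , j) , t)) (inj₁ ((v , j′) , t′))
  boundary-sound j j′ {t} refl same = Sum.[ equal , routed ] (∨-split ⌊ j ≟F j′ ⌋ same)
    where
    equal : T ⌊ j ≟F j′ ⌋ → EqClosure Faces (inj₁ ((v , j) , t)) (inj₁ ((v , j′) , t))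
    equal j≡j′ = ≡⇒EqClosure (cong (λ i → inj₁ ((v , i) , t)) (toWitness j≡j′))
    routed : T ⌊ routeV j t ≟F j′ ⌋ → EqClosure Faces (inj₁ ((v , j) , t)) (inj₁ ((v , j′) , t))
    routed r≡j′ = EqClosure.return (lift (inj₂
      (cong (λ i → (v , i) , t) (trans (sym (toWitness r≡j′)) (sym (routeAtV j t))))))

  sameFace-sound : ∀ l l′ → T (sameFace l l′) → EqClosure Faces (faceOf l) (faceOf l′)
  sameFace-sound (inj₁ (j , t)) (inj₁ (j′ , t′)) same =
    boundary-sound j j′ (toWitness (proj₁ split)) (proj₂ split)
    where split = ∧-split {⌊ t ≟Ty t′ ⌋} same
  sameFace-sound (inj₂ r) (inj₂ r′) same = ≡⇒EqClosure (cong (faceOf ∘ inj₂) (toWitness same))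

  meets-sound : ∀ f b e e′ → T (meets f b e e′) → EqClosure (StrandStep H) (end e) (end e′)
  meets-sound (suc f) true e e′ found = Sum.[ here , turned ] (∨-split ⌊ e ≟E e′ ⌋ found)
    where
    here : T ⌊ e ≟E e′ ⌋ → EqClosure (StrandStep H) (end e) (end e′)
    here e≡e′ = ≡⇒EqClosure (cong end (toWitness e≡e′))
    turned : T (meets f false (turn e) e′) → EqClosure (StrandStep H) (end e) (end e′)
    turned later = EqClosure.return (inj₂ refl) ◅◅ meets-sound f false (turn e) e′ later
  meets-sound (suc f) false e@(a , i , t) e′ found =
    Sum.[ here , across (link a i) refl ] (∨-split ⌊ e ≟E e′ ⌋ found)
    where
    here : T ⌊ e ≟E e′ ⌋ → EqClosure (StrandStep H) (end e) (end e′)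
    here e≡e′ = ≡⇒EqClosure (cong end (toWitness e≡e′))
    across : ∀ l → link a i ≡ l → T (meetsAcross f t e′ l) → EqClosure (StrandStep H) (end e) (end e′)
    across (inside b k) eq later =
      EqClosure.return (inj₁ (cong (λ l → linkHalfEdge l , t) (sym eq)))
        ◅◅ meets-sound f true (b , k , t) e′ later

  connected-sound : ∀ e e′ → T (connected e e′) → EqClosure (StrandStep H) (end e) (end e′)
  connected-sound e e′ conn =
    Sum.[ meets-sound fuel true e e′ , meets-sound fuel false e e′ ] (∨-split (meets fuel true e e′) conn)

  toFaces-resolve : ∀ h t → EqClosure Faces (toFaces (resolve h , t)) (inj₁ (h , t))
  toFaces-resolve (y , j) t = at (y ≟V v)
    where
    at : (d : Dec (y ≡ v)) → EqClosure Faces (toFaces (resolveAt (y , j) d , t)) (inj₁ ((y , j) , t))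
    at (yes refl) = sameFace-sound (label (boundaryEnd j t)) (inj₁ (j , t)) (port-labels j t)
    at (no _)     = ε

  toFaces-across : ∀ t l → EqClosure Faces (faceOf (labelAcross t l)) (toFaces (linkHalfEdge l , t))
  toFaces-across t (inside b k) = ε
  toFaces-across t (outside j) =
    EqClosure.return (lift (inj₁ refl)) ◅◅ EqClosure.symmetric Faces (toFaces-resolve (α (v , j)) t)

  toFaces-cong : ∀ {x y} → StrandStep H x y → EqClosure Faces (toFaces x) (toFaces y)
  toFaces-cong {(inj₁ (x , _) , i) , t} (inj₁ refl) =
    EqClosure.return (lift (inj₁ refl)) ◅◅ EqClosure.symmetric Faces (toFaces-resolve (α (x , i)) t)
  toFaces-cong {(inj₁ _ , _) , _} (inj₂ refl) = EqClosure.return (lift (inj₂ refl))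
  toFaces-cong {(inj₂ a , i) , t} (inj₁ refl) =
    sameFace-sound (label (a , i , t)) (labelAcross t (link a i)) (link-labels (a , i , t))
      ◅◅ toFaces-across t (link a i)
  toFaces-cong {(inj₂ a , i) , t} (inj₂ refl) =
    sameFace-sound (label (a , i , t)) (label (turn (a , i , t))) (turn-labels (a , i , t))

  fromFaces-cong : ∀ {x y} → Faces x y → EqClosure (StrandStep H) (fromFaces x) (fromFaces y)
  fromFaces-cong {inj₁ ((x , i) , t)} (lift (inj₁ refl)) = at (x ≟V v)
    where
    at : (d : Dec (x ≡ v)) → EqClosure (StrandStep H) (resolveAt (x , i) d , t) (resolve (α (x , i)) , t)
    at (yes refl) = EqClosure.return (inj₁ (cong (_, t) (sym (port-α i))))
    at (no _)     = EqClosure.return (inj₁ refl)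
  fromFaces-cong {inj₁ ((x , i) , t)} (lift (inj₂ refl)) = at (x ≟V v)
    where
    at : (d : Dec (x ≡ v)) → EqClosure (StrandStep H)
      (resolveAt (x , i) d , t) (resolveAt (x , route (kind x) (out (x , i)) i t) d , t)
    at (yes refl) =
      subst (λ r → EqClosure (StrandStep H) (end (boundaryEnd i t)) (end (boundaryEnd r t)))
        (sym (routeAtV i t))
        (connected-sound (boundaryEnd i t) (boundaryEnd (routeV i t) t) (routes-connected i t))
    at (no _)     = EqClosure.return (inj₂ refl)

  fromFaces-faceOf : ∀ l → T (represented l) → fromFaces (faceOf l) ≡ end (target l)
  fromFaces-faceOf (inj₁ (j , t)) _ = cong (_, t) (resolve-v j)
  fromFaces-faceOf (inj₂ r@(_ , i , t)) = indexed (index r)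
    where
    indexed : (m : Maybe (Fin K)) → T (maybe′ (λ c → ⌊ representative c ≟E r ⌋) false m) →
      fromFaces (maybe′ inj₂ (inj₁ ((v , i) , t)) m) ≡ end r
    indexed (just c) rep = cong end (toWitness rep)

  faceOf-indexes : ∀ c l → T (indexes c l) → faceOf l ≡ inj₂ c
  faceOf-indexes c (inj₂ r@(_ , i , t)) = indexed (index r)
    where
    indexed : (m : Maybe (Fin K)) → T (maybe′ (λ c′ → ⌊ c′ ≟F c ⌋) false m) →
      maybe′ inj₂ (inj₁ ((v , i) , t)) m ≡ inj₂ c
    indexed (just c′) idx = cong inj₂ (toWitness idx)

  fromFaces∘toFaces : ∀ x → EqClosure (StrandStep H) (fromFaces (toFaces x)) x
  fromFaces∘toFaces ((inj₁ (x , x≢v) , i) , t) = ≡⇒EqClosure (cong (_, t) (resolve-old x x≢v i))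
  fromFaces∘toFaces ((inj₂ a , i) , t) =
    subst (λ z → EqClosure (StrandStep H) z (end e)) (sym (fromFaces-faceOf (label e) (closed-indexed e)))
      (EqClosure.symmetric (StrandStep H) (connected-sound e (target (label e)) (labels-connected e)))
    where
    e = (a , i , t)

  toFaces∘fromFaces : ∀ z → EqClosure Faces (toFaces (fromFaces z)) z
  toFaces∘fromFaces (inj₁ (h , t)) = toFaces-resolve h t
  toFaces∘fromFaces (inj₂ c) =
    ≡⇒EqClosure (faceOf-indexes c (label (representative c)) (representatives-indexed c))

  faces-equivalence : ClassEquivalence (StrandStep H) Faces
  faces-equivalence = record
    { to = toFaces ; from = fromFaces
    ; to-cong = λ {x} {y} → toFaces-cong {x} {y} ; from-cong = λ {x} {y} → fromFaces-cong {x} {y}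
    ; from∘to = fromFaces∘toFaces ; to∘from = toFaces∘fromFaces }

  reachesRoot-sound : ∀ f a → T (reachesRoot f a) → EqClosure (Adjacent H) (inj₂ a) (inj₂ root)
  reachesRoot-sound zero a found = ≡⇒EqClosure (cong inj₂ (toWitness found))
  reachesRoot-sound (suc f) a found =
    Sum.[ here , (λ viaLink → across (toWitness viaLink)) ] (∨-split ⌊ a ≟F root ⌋ found)
    where
    here : T ⌊ a ≟F root ⌋ → EqClosure (Adjacent H) (inj₂ a) (inj₂ root)
    here a≡root = ≡⇒EqClosure (cong inj₂ (toWitness a≡root))
    across : (∃ λ i → T (reachesAcross f (link a i))) → EqClosure (Adjacent H) (inj₂ a) (inj₂ root)
    across (i , later) = through (link a i) refl later
      where
      through : ∀ l → link a i ≡ l → T (reachesAcross f l) →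
        EqClosure (Adjacent H) (inj₂ a) (inj₂ root)
      through (inside b k) eq later =
        EqClosure.return (i , k , cong linkHalfEdge eq) ◅◅ reachesRoot-sound f b later

  root-connected : ∀ a → EqClosure (Adjacent H) (inj₂ root) (inj₂ a)
  root-connected a = EqClosure.symmetric (Adjacent H) (reachesRoot-sound size a (gadget-connected a))

  -- The gadget is connected, so collapsing it back to v identifies the components.
  collapse : Vtx′ → Vtx
  collapse (inj₁ (x , _)) = x
  collapse (inj₂ _)       = v

  expand : Vtx → Vtx′
  expand x = proj₁ (resolve (x , zero))

  collapse-resolve : ∀ h → collapse (proj₁ (resolve h)) ≡ proj₁ h
  collapse-resolve (y , j) = at (y ≟V v)
    where
    at : (d : Dec (y ≡ v)) → collapse (proj₁ (resolveAt (y , j) d)) ≡ y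
    at (yes y≡v) = sym y≡v
    at (no _)    = refl

  expand-resolve : ∀ h → EqClosure (Adjacent H) (expand (proj₁ h)) (proj₁ (resolve h))
  expand-resolve (y , j) = at (y ≟V v)
    where
    at : (d : Dec (y ≡ v)) →
      EqClosure (Adjacent H) (proj₁ (resolveAt (y , zero) d)) (proj₁ (resolveAt (y , j) d))
    at (yes _) = root-connected _
    at (no _)  = ε

  adjacent-resolve : ∀ x i {h′} → resolve (α (x , i)) ≡ h′ → Adjacent G x (collapse (proj₁ h′))
  adjacent-resolve x i refl =
    i , proj₂ (α (x , i)) , cong (_, proj₂ (α (x , i))) (sym (collapse-resolve (α (x , i))))

  collapse-cong : ∀ {x y} → Adjacent H x y → EqClosure (Adjacent G) (collapse x) (collapse y)
  collapse-cong {inj₁ (x , _)} (i , _ , eq) = EqClosure.return (adjacent-resolve x i eq)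
  collapse-cong {inj₂ a} {y} (i , j , eq) = across (link a i) eq
    where
    across : ∀ l → linkHalfEdge l ≡ (y , j) → EqClosure (Adjacent G) v (collapse y)
    across (inside _ _) refl = ε
    across (outside j′) eq   = EqClosure.return (adjacent-resolve v j′ eq)

  expand-cong : ∀ {x y} → Adjacent G x y → EqClosure (Adjacent H) (expand x) (expand y)
  expand-cong {x} {y} (i , j , eq) =
    fromExpanded (x ≟V v) ◅◅ ≡⇒EqClosure (cong (proj₁ ∘ resolve) eq)
      ◅◅ EqClosure.symmetric (Adjacent H) (expand-resolve (y , j))
    where
    fromExpanded : (d : Dec (x ≡ v)) →
      EqClosure (Adjacent H) (proj₁ (resolveAt (x , zero) d)) (proj₁ (resolve (α (x , i))))
    fromExpanded (yes refl) =
      root-connected (proj₁ (port i))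
        ◅◅ EqClosure.return (proj₂ (port i) , proj₂ (resolve (α (v , i))) , port-α i)
    fromExpanded (no _) = EqClosure.return (i , proj₂ (resolve (α (x , i))) , refl)

  expand∘collapse : ∀ y → EqClosure (Adjacent H) (expand (collapse y)) y
  expand∘collapse (inj₁ (x , x≢v)) = ≡⇒EqClosure (cong proj₁ (resolve-old x x≢v zero))
  expand∘collapse (inj₂ a) = ≡⇒EqClosure (cong proj₁ (resolve-v zero)) ◅◅ root-connected a

  collapse∘expand : ∀ x → EqClosure (Adjacent G) (collapse (expand x)) x
  collapse∘expand x = ≡⇒EqClosure (collapse-resolve (x , zero))

  components-equivalence : ClassEquivalence (Adjacent G) (Adjacent H)
  components-equivalence = record
    { to = expand ; from = collapse
    ; to-cong = λ {x} {y} → expand-cong {x} {y} ; from-cong = λ {x} {y} → collapse-cong {x} {y}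
    ; from∘to = collapse∘expand ; to∘from = expand∘collapse }

  module _ (p : Kind → Bool) where
    OldOfKind : Set
    OldOfKind = Σ Old (T ∘ p ∘ kind ∘ proj₁)

    ofKind-G : Σ Vtx (T ∘ p ∘ kind) ↔ (OldOfKind ⊎ Fin (bit (p kv)))
    ofKind-G =
      ↔-trans (mk↔ₛ′ separate merge separate∘merge merge∘separate) (↔-refl ⊎-↔ T↔bit (p kv))
      where
      separateAt : (x : Vtx) → T (p (kind x)) → Dec (x ≡ v) → OldOfKind ⊎ T (p kv)
      separateAt x px (yes x≡v) = inj₂ (subst (T ∘ p) (trans (cong kind x≡v) v-kind) px)
      separateAt x px (no x≢v)  = inj₁ ((x , fromWitnessFalse x≢v) , px)
      separate : Σ Vtx (T ∘ p ∘ kind) → OldOfKind ⊎ T (p kv)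
      separate (x , px) = separateAt x px (x ≟V v)
      merge : OldOfKind ⊎ T (p kv) → Σ Vtx (T ∘ p ∘ kind)
      merge (inj₁ ((x , _) , px)) = x , px
      merge (inj₂ pv)             = v , subst (T ∘ p) (sym v-kind) pv
      merge∘separate : ∀ y → merge (separate y) ≡ y
      merge∘separate (x , px) = at (x ≟V v)
        where
        at : (d : Dec (x ≡ v)) → merge (separateAt x px d) ≡ (x , px)
        at (yes refl) = Σ-≡,≡→≡ (refl , T-irrelevant _ _)
        at (no _)     = refl
      separate∘merge : ∀ z → separate (merge z) ≡ z
      separate∘merge (inj₁ ((x , x≢v) , px)) = at (x ≟V v)
        where
        at : (d : Dec (x ≡ v)) → separateAt x px d ≡ inj₁ ((x , x≢v) , px)
        at (yes x≡v) = ⊥-elim (toWitnessFalse x≢v x≡v)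
        at (no _)    = cong (λ q → inj₁ ((x , q) , px)) (T-irrelevant _ _)
      separate∘merge (inj₂ pv) = at (v ≟V v)
        where
        at : (d : Dec (v ≡ v)) → separateAt v (subst (T ∘ p) (sym v-kind) pv) d ≡ inj₂ pv
        at (yes _)   = cong inj₂ (T-irrelevant _ _)
        at (no v≢v)  = ⊥-elim (v≢v refl)

    ofKind-H : Σ Vtx′ (T ∘ p ∘ MOGraph.kind H) ↔ (OldOfKind ⊎ Fin (count (p ∘ kindΓ)))
    ofKind-H = ↔-trans Σ-⊎-↔ (↔-refl ⊎-↔ count-↔ (p ∘ kindΓ))

  sameTwiceDegree : SameTwiceDegree G H
  sameTwiceDegree .SameTwiceDegree.at d = forward , backward
    where
    forward : HasTwiceDegree G d → HasTwiceDegree H d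
    forward (c , nV , nF , nU , nB , comps , stds , faces , unbs , brks , d≡)
      with count-exchange _ _ (ofKind-G isStd) (ofKind-H isStd) stds
         | count-exchange _ _ (ofKind-G isUnbroken) (ofKind-H isUnbroken) unbs
         | count-exchange _ _ (ofKind-G isBroken) (ofKind-H isBroken) brks
    ... | nV′ , stds′ , eV | nU′ , unbs′ , eU | nB′ , brks′ , eB =
      c , nV′ , nF + K , nU′ , nB′ ,
      numClasses-transport components-equivalence comps , stds′ ,
      numClasses-transport (ClassEquivalence-sym faces-equivalence) (withIsolated⁺ faces) ,
      unbs′ , brks′ ,
      trans d≡ (sym (twiceDegree-exchange c nF nV nU nB nV′ nU′ nB′ _ _ _ _ _ _ K eV eU eB weight-balance))

    backward : HasTwiceDegree H d → HasTwiceDegree G d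
    backward (c , nV′ , nF′ , nU′ , nB′ , comps , stds , faces , unbs , brks , d≡)
      with count-exchange _ _ (ofKind-H isStd) (ofKind-G isStd) stds
         | count-exchange _ _ (ofKind-H isUnbroken) (ofKind-G isUnbroken) unbs
         | count-exchange _ _ (ofKind-H isBroken) (ofKind-G isBroken) brks
         | withIsolated⁻ (numClasses-transport faces-equivalence faces)
    ... | nV , stds′ , eV | nU , unbs′ , eU | nB , brks′ , eB | nF , refl , faces′ =
      c , nV , nF , nU , nB ,
      numClasses-transport (ClassEquivalence-sym components-equivalence) comps ,
      stds′ , faces′ , unbs′ , brks′ ,
      trans d≡ (twiceDegree-exchange c nF nV nU nB nV′ nU′ nB′ _ _ _ _ _ _ K
                  (sym eV) (sym eU) (sym eB) weight-balance)

-- The kind of a chain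

extendKind : Ty → ChainKind → ChainKind
extendKind L cL  = cL
extendKind R cR  = cR
extendKind S cSe = cSo
extendKind S cSo = cSe
extendKind _ _   = cB

dipoleKind : Ty → ChainKind
dipoleKind L = cL
dipoleKind S = cSo
dipoleKind R = cR

chainKind : ∀ {m} → Vec Ty (suc m) → ChainKind
chainKind (t ∷ [])          = dipoleKind t
chainKind (t ∷ ts@(_ ∷ _)) = extendKind t (chainKind ts)

uniformKind : Ty → ℕ → ChainKind
uniformKind L _       = cL
uniformKind R _       = cR
uniformKind S zero    = cSe
uniformKind S (suc n) = extendKind S (uniformKind S n)

chainKind-uniform : ∀ t {m} (ts : Vec Ty (suc m)) → All (_≡ t) ts → chainKind ts ≡ uniformKind t (suc m)
chainKind-uniform L (_ ∷ [])          (refl ∷ [])  = refl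
chainKind-uniform R (_ ∷ [])          (refl ∷ [])  = refl
chainKind-uniform S (_ ∷ [])          (refl ∷ [])  = refl
chainKind-uniform t (_ ∷ ts@(_ ∷ _)) (refl ∷ all) =
  trans (cong (extendKind t) (chainKind-uniform t ts all)) (extend-uniform t)
  where
  extend-uniform : ∀ t {n} → extendKind t (uniformKind t n) ≡ uniformKind t (suc n)
  extend-uniform L = refl
  extend-uniform R = refl
  extend-uniform S = refl

uniformKind-even : ∀ n → 2 ∣ n → uniformKind S n ≡ cSe
uniformKind-odd  : ∀ n → ¬ 2 ∣ n → uniformKind S n ≡ cSo
uniformKind-even zero          _     = refl
uniformKind-even (suc zero)    2∣1   with () ← ∣1⇒≡1 2∣1
uniformKind-even (suc (suc n)) 2∣n+2 =
  cong (extendKind S ∘ extendKind S) (uniformKind-even n (∣m+n∣m⇒∣n 2∣n+2 ∣-refl))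
uniformKind-odd zero          2∤0   = ⊥-elim (2∤0 (2 ∣0))
uniformKind-odd (suc zero)    _     = refl
uniformKind-odd (suc (suc n)) 2∤n+2 =
  cong (extendKind S ∘ extendKind S) (uniformKind-odd n (2∤n+2 ∘ ∣m∣n⇒∣m+n ∣-refl))

uniformKind-S : ∀ n → uniformKind S n ≡ cSe ⊎ uniformKind S n ≡ cSo
uniformKind-S zero = inj₁ refl
uniformKind-S (suc n) with uniformKind-S n
... | inj₁ even = inj₂ (cong (extendKind S) even)
... | inj₂ odd  = inj₁ (cong (extendKind S) odd)

extendKind-cB : ∀ t → extendKind t cB ≡ cB
extendKind-cB L = refl
extendKind-cB S = refl
extendKind-cB R = refl

extendKind-mismatch : ∀ t t′ n → t ≢ t′ → extendKind t (uniformKind t′ n) ≡ cB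
extendKind-mismatch L L _ t≢t′ = ⊥-elim (t≢t′ refl)
extendKind-mismatch S S _ t≢t′ = ⊥-elim (t≢t′ refl)
extendKind-mismatch R R _ t≢t′ = ⊥-elim (t≢t′ refl)
extendKind-mismatch L R _ _ = refl
extendKind-mismatch S L _ _ = refl
extendKind-mismatch S R _ _ = refl
extendKind-mismatch R L _ _ = refl
extendKind-mismatch L S n _ with uniformKind-S n
... | inj₁ even rewrite even = refl
... | inj₂ odd  rewrite odd  = refl
extendKind-mismatch R S n _ with uniformKind-S n
... | inj₁ even rewrite even = refl
... | inj₂ odd  rewrite odd  = refl

chainKind-broken : ∀ {m} (ts : Vec Ty (suc m)) → chainKind ts ≡ cB ⊎ All (_≡ head ts) ts
chainKind-broken (t ∷ []) = inj₂ (refl ∷ [])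
chainKind-broken (t ∷ ts@(t′ ∷ _)) with chainKind-broken ts
... | inj₁ broken = inj₁ (trans (cong (extendKind t) broken) (extendKind-cB t))
... | inj₂ all with t ≟Ty t′
...   | yes refl = inj₂ (refl ∷ all)
...   | no t≢t′  =
  inj₁ (trans (cong (extendKind t) (chainKind-uniform t′ ts all)) (extendKind-mismatch t t′ _ t≢t′))

chainFits⇒chainKind : ∀ k {m} (ts : Vec Ty (suc m)) → ChainFits k ts → toKind (chainKind ts) ≡ k
chainFits⇒chainKind chL ts all = cong toKind (chainKind-uniform L ts all)
chainFits⇒chainKind chR ts all = cong toKind (chainKind-uniform R ts all)
chainFits⇒chainKind chSe ts (all , even) =
  cong toKind (trans (chainKind-uniform S ts all) (uniformKind-even _ even))
chainFits⇒chainKind chSo ts (all , odd)  =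
  cong toKind (trans (chainKind-uniform S ts all) (uniformKind-odd _ odd))
chainFits⇒chainKind chB ts (i , j , ts[i]≢ts[j]) with chainKind-broken ts
... | inj₁ broken = cong toKind broken
... | inj₂ all    = ⊥-elim (ts[i]≢ts[j] (trans (lookup⁺ all i) (sym (lookup⁺ all j))))

-- The gadgets of a chain

dipoleLink : ∀ {n} → Ty → (Fin 2 → Fin n) → (Fin 2 → Fin 2 → Link n) → Fin 2 → Fin 4 → Link n
dipoleLink t at attach s k with role t s k
... | inner s′ k′ = inside (at s′) k′
... | ext sd ps   = attach sd ps

chainSide : Fin 4 → Fin 2
chainSide s0 = p0
chainSide s1 = p0
chainSide s2 = p1
chainSide s3 = p1

chainPosition : Fin 4 → Fin 2
chainPosition s0 = p0
chainPosition s1 = p1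
chainPosition s2 = p0
chainPosition s3 = p1

-- Vertex 0 is a chain-vertex of kind k, vertices 1 and 2 form a dipole of type t
-- whose side 1 is joined to side 0 of the chain-vertex.
peelGadget : Ty → ChainKind → Gadget
peelGadget t k = record
  { size = 3
  ; kind = λ { zero → toKind k ; (suc _) → std }
  ; link = λ { zero j → chainVertexLink (chainSide j) (chainPosition j)
             ; (suc s) → dipoleLink t suc dipoleSide s }
  ; port = λ { s0 → map₁ suc (extH t p0 p0) ; s1 → map₁ suc (extH t p0 p1)
             ; s2 → zero , s2 ; s3 → zero , s3 }
  }
  where
  chainVertexLink : Fin 2 → Fin 2 → Link 3
  chainVertexLink p0 ps = uncurry (inside ∘ suc) (extH t p1 (flip2 ps))
  chainVertexLink p1 ps = outside (chainSlot p1 ps)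
  dipoleSide : Fin 2 → Fin 2 → Link 3
  dipoleSide p0 ps = outside (chainSlot p0 ps)
  dipoleSide p1 ps = inside zero (chainSlot p0 (flip2 ps))

-- Vertices 0 and 1 form a dipole of type t, vertices 2 and 3 one of type t′.
pairGadget : Ty → Ty → Gadget
pairGadget t t′ = record
  { size = 4
  ; kind = λ _ → std
  ; link = λ { zero → dipoleLink t first firstSide zero
             ; (suc zero) → dipoleLink t first firstSide (suc zero)
             ; (suc (suc s)) → dipoleLink t′ second secondSide s }
  ; port = λ { s0 → map₁ first (extH t p0 p0) ; s1 → map₁ first (extH t p0 p1)
             ; s2 → map₁ second (extH t′ p1 p0) ; s3 → map₁ second (extH t′ p1 p1) }
  }
  where
  first second : Fin 2 → Fin 4
  first s = s ↑ˡ 2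
  second s = 2 ↑ʳ s
  firstSide : Fin 2 → Fin 2 → Link 4
  firstSide p0 ps = outside (chainSlot p0 ps)
  firstSide p1 ps = uncurry (inside ∘ second) (extH t′ p0 (flip2 ps))
  secondSide : Fin 2 → Fin 2 → Link 4
  secondSide p0 ps = uncurry (inside ∘ first) (extH t p1 (flip2 ps))
  secondSide p1 ps = outside (chainSlot p1 ps)

peelGadget-check : ∀ t k → T (Checks.valid (FaceSearch.faceLabelling (peelGadget t k)) (extendKind t k))
peelGadget-check L cL = tt
peelGadget-check L cR = tt
peelGadget-check L cSe = tt
peelGadget-check L cSo = tt
peelGadget-check L cB = tt
peelGadget-check S cL = tt
peelGadget-check S cR = tt
peelGadget-check S cSe = tt
peelGadget-check S cSo = tt
peelGadget-check S cB = tt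
peelGadget-check R cL = tt
peelGadget-check R cR = tt
peelGadget-check R cSe = tt
peelGadget-check R cSo = tt
peelGadget-check R cB = tt

pairGadget-check : ∀ t t′ →
  T (Checks.valid (FaceSearch.faceLabelling (pairGadget t t′)) (extendKind t (dipoleKind t′)))
pairGadget-check L L = tt
pairGadget-check L S = tt
pairGadget-check L R = tt
pairGadget-check S L = tt
pairGadget-check S S = tt
pairGadget-check S R = tt
pairGadget-check R L = tt
pairGadget-check R S = tt
pairGadget-check R R = tt

peelGadget-valid : ∀ t k → Checks.Valid (FaceSearch.faceLabelling (peelGadget t k)) (extendKind t k)
peelGadget-valid t k =
  Checks.valid⇒Valid (FaceSearch.faceLabelling (peelGadget t k)) (extendKind t k) (peelGadget-check t k)

pairGadget-valid : ∀ t t′ →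
  Checks.Valid (FaceSearch.faceLabelling (pairGadget t t′)) (extendKind t (dipoleKind t′))
pairGadget-valid t t′ = Checks.valid⇒Valid (FaceSearch.faceLabelling (pairGadget t t′))
  (extendKind t (dipoleKind t′)) (pairGadget-check t t′)

-- Substituting a chain is replacing by gadgets, one after the other

module PairSubstitution (G : MOGraph) (v : MOGraph.Vtx G) (t t′ : Ty) where
  open MOGraph G
  private
    module C = Substitution G v (t ∷ t′ ∷ [])
    module P = Replacement G v (pairGadget t t′)

  to : C.Vtx' → P.Vtx′
  to (inj₁ o)              = inj₁ o
  to (inj₂ (zero , s))     = inj₂ (s ↑ˡ 2)
  to (inj₂ (suc zero , s)) = inj₂ (2 ↑ʳ s)

  from : P.Vtx′ → C.Vtx'
  from (inj₁ o)                = inj₁ o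
  from (inj₂ zero)             = inj₂ (zero , zero)
  from (inj₂ (suc zero))       = inj₂ (zero , suc zero)
  from (inj₂ (suc (suc s)))    = inj₂ (suc zero , s)

  resolve-to : ∀ h → P.resolve h ≡ map₁ to (C.resolve h)
  resolve-to (y , j) with y ≟V v
  resolve-to (y , s0) | yes _ = refl
  resolve-to (y , s1) | yes _ = refl
  resolve-to (y , s2) | yes _ = refl
  resolve-to (y , s3) | yes _ = refl
  ... | no _ = refl

  α-to : ∀ x k → MOGraph.α (replace G v (pairGadget t t′)) (to x , k) ≡ map₁ to (C.α' (x , k))
  α-to (inj₁ (x , _)) k = resolve-to (α (x , k))
  α-to (inj₂ (zero , zero)) k with role t zero k
  ... | inner _ _ = refl
  ... | ext p0 ps = resolve-to (α (v , chainSlot p0 ps))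
  ... | ext p1 _  = refl
  α-to (inj₂ (zero , suc zero)) k with role t (suc zero) k
  ... | inner _ _ = refl
  ... | ext p0 ps = resolve-to (α (v , chainSlot p0 ps))
  ... | ext p1 _  = refl
  α-to (inj₂ (suc zero , s)) k with role t′ s k
  ... | inner _ _ = refl
  ... | ext p0 _  = refl
  ... | ext p1 ps = resolve-to (α (v , chainSlot p1 ps))

  ≅-pair : substitute G v (t ∷ t′ ∷ []) ≅ replace G v (pairGadget t t′)
  ≅-pair = record
    { to = to ; from = from
    ; from∘to = λ { (inj₁ _) → refl ; (inj₂ (zero , zero)) → refl ; (inj₂ (zero , suc zero)) → refl
                  ; (inj₂ (suc zero , zero)) → refl ; (inj₂ (suc zero , suc zero)) → refl }
    ; to∘from = λ { (inj₁ _) → refl ; (inj₂ zero) → refl ; (inj₂ (suc zero)) → refl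
                  ; (inj₂ (suc (suc zero))) → refl ; (inj₂ (suc (suc (suc zero)))) → refl }
    ; kind-to = λ { (inj₁ _) → refl ; (inj₂ (zero , _)) → refl ; (inj₂ (suc zero , _)) → refl }
    ; out-to = λ { (inj₁ _) _ → refl ; (inj₂ (zero , zero)) _ → refl ; (inj₂ (zero , suc zero)) _ → refl
                 ; (inj₂ (suc zero , _)) _ → refl }
    ; α-to = α-to
    }

module PeelSubstitution (G : MOGraph) (v : MOGraph.Vtx G) (t : Ty) {q : ℕ} (ts : Vec Ty (suc (suc q))) where
  open MOGraph G
  private
    module P = Replacement G v (peelGadget t (chainKind ts))
    H : MOGraph
    H = replace G v (peelGadget t (chainKind ts))
    v′ : P.Vtx′
    v′ = inj₂ zero
    module C = Substitution G v (t ∷ ts)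
    module D = Substitution H v′ ts

  to : C.Vtx' → D.Vtx'
  to (inj₁ o)           = inj₁ (inj₁ o , tt)
  to (inj₂ (zero , s))  = inj₁ (inj₂ (suc s) , tt)
  to (inj₂ (suc i , s)) = inj₂ (i , s)

  from : D.Vtx' → C.Vtx'
  from (inj₁ (inj₁ o , _))          = inj₁ o
  from (inj₁ (inj₂ zero , ()))
  from (inj₁ (inj₂ (suc s) , _))    = inj₂ (zero , s)
  from (inj₂ (i , s))               = inj₂ (suc i , s)

  resolve-to : ∀ h → D.resolve (P.resolve h) ≡ map₁ to (C.resolve h)
  resolve-to (y , j) with y ≟V v
  resolve-to (y , s0) | yes _ = refl
  resolve-to (y , s1) | yes _ = refl
  resolve-to (y , s2) | yes _ = refl
  resolve-to (y , s3) | yes _ = refl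
  ... | no _ = refl

  v′-side₁ : ∀ ps →
    D.resolve (MOGraph.α H (v′ , chainSlot p1 ps)) ≡ map₁ to (C.resolve (α (v , chainSlot p1 ps)))
  v′-side₁ p0 = resolve-to (α (v , s2))
  v′-side₁ p1 = resolve-to (α (v , s3))

  α-to : ∀ x k → D.α' (to x , k) ≡ map₁ to (C.α' (x , k))
  α-to (inj₁ (x , _)) k = resolve-to (α (x , k))
  α-to (inj₂ (zero , s)) k with role t s k
  ... | inner _ _ = refl
  ... | ext p0 ps = resolve-to (α (v , chainSlot p0 ps))
  ... | ext p1 p0 = refl
  ... | ext p1 p1 = refl
  α-to (inj₂ (suc i , s)) k with role (lookup ts i) s k
  ... | inner _ _ = refl
  α-to (inj₂ (suc zero , s))    k | ext p0 p0 = refl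
  α-to (inj₂ (suc zero , s))    k | ext p0 p1 = refl
  α-to (inj₂ (suc (suc _) , s)) k | ext p0 _  = refl
  α-to (inj₂ (suc zero , s))    k | ext p1 _  = refl
  α-to (inj₂ (suc (suc j) , s)) k | ext p1 ps
    with suc (suc q) ℕ.≟ toℕ (suc (suc j)) | suc q ℕ.≟ toℕ (suc j)
  ... | yes _        | yes _        = v′-side₁ ps
  ... | no last≢     | no last≢′    =
        cong (λ r → D.dipHE (suc r) p0 (flip2 ps)) (lower₁-irrelevant (suc j) last≢′ (last≢ ∘ cong suc))
  ... | yes last≡    | no last≢′    = ⊥-elim (last≢′ (suc-injective last≡))
  ... | no last≢     | yes last≡′   = ⊥-elim (last≢ (cong suc last≡′))

  ≅-peel : substitute G v (t ∷ ts) ≅ substitute H v′ ts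
  ≅-peel = record
    { to = to ; from = from
    ; from∘to = λ { (inj₁ _) → refl ; (inj₂ (zero , _)) → refl ; (inj₂ (suc _ , _)) → refl }
    ; to∘from = λ { (inj₁ (inj₁ _ , _)) → refl ; (inj₁ (inj₂ (suc _) , _)) → refl ; (inj₂ _) → refl }
    ; kind-to = λ { (inj₁ _) → refl ; (inj₂ (zero , _)) → refl ; (inj₂ (suc _ , _)) → refl }
    ; out-to  = λ { (inj₁ _) _ → refl ; (inj₂ (zero , _)) _ → refl ; (inj₂ (suc _ , _)) _ → refl }
    ; α-to    = α-to
    }

substitute-sameTwiceDegree : ∀ {q} (G : MOGraph) (v : MOGraph.Vtx G) (ts : Vec Ty (suc (suc q))) →
  MOGraph.kind G v ≡ toKind (chainKind ts) → SameTwiceDegree G (substitute G v ts)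
substitute-sameTwiceDegree {zero} G v (t ∷ t′ ∷ []) v-kind =
  sameTwiceDegree-trans
    (Soundness.sameTwiceDegree G v (FaceSearch.faceLabelling (pairGadget t t′)) v-kind (pairGadget-valid t t′))
    (≅⇒sameTwiceDegree (≅-sym (PairSubstitution.≅-pair G v t t′)))
substitute-sameTwiceDegree {suc q} G v (t ∷ ts@(_ ∷ _ ∷ _)) v-kind =
  sameTwiceDegree-trans
    (Soundness.sameTwiceDegree G v (FaceSearch.faceLabelling (peelGadget t (chainKind ts))) v-kind
      (peelGadget-valid t (chainKind ts)))
    (sameTwiceDegree-trans
      (substitute-sameTwiceDegree (replace G v (peelGadget t (chainKind ts))) (inj₂ zero) ts refl)
      (≅⇒sameTwiceDegree (≅-sym (PeelSubstitution.≅-peel G v t ts))))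

lemma3p5 : (G : MOGraph) → FiniteGraph G → WellFormed G →
    (v : MOGraph.Vtx G) (q : ℕ) (ts : Vec Ty (suc (suc q))) →
    ChainFits (MOGraph.kind G v) ts →
    (d : ℤ) →
      (HasTwiceDegree G d → HasTwiceDegree (substitute G v ts) d) ×
      (HasTwiceDegree (substitute G v ts) d → HasTwiceDegree G d)
lemma3p5 G _ _ v q ts fits =
  SameTwiceDegree.at
    (substitute-sameTwiceDegree G v ts (sym (chainFits⇒chainKind (MOGraph.kind G v) ts fits)))
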